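{- For each integer $n\ge1$ and prime $p$ coprime to $n$, let $d$ be the multiplicative order of $p$ modulo $n$. Then $|GP(n,p)|=n\phi(n)/d$, and $|GP(n,p,c)|=\phi(n)/d$ for each $c\in{\mathbb Z}_n$, where $\phi$ is Euler's function.
   Context: A regular dessin is determined up to isomorphism by a triple $(G;x,y)$ with $G$ a finite group generated by $x,y$; $(G;x,y)$ and $(G';x',y')$ give isomorphic dessins iff some isomorphism $G\to G'$ sends $x\mapsto x'$, $y\mapsto y'$. Generalised Paley dessins: let $p$ be prime, $d\ge1$, $q=p^d$. Let ${\rm AGL}_1(q)$ be the group of maps $t\mapsto at+b$ of ${\mathbb F}_q$ ($a\ne0$), $T=\{t\mapsto t+b\}$. For a subgroup $S\le{\mathbb F}_q^*$ of order $n$ (identified with $\{t\mapsto at:a\in S\}$), $G_S=T\rtimes S=\{t\mapsto at+b: a\in S,b\in{\mathbb F}_q\}$, where either $n=d=1$, or $n>1$ and $p$ has multiplicative order $d$ mod $n$. For $x$ a generator of $S$ and $y\in G_S\setminus S$, the regular dessin $(G_S;x,y)$ is a generalised Paley dessin with valency $n$ and field characteristic $p$; its colour constant is the unique $c\in{\mathbb Z}_n$ with $y\in Tx^c$. $GP(n,p)$ denotes the set of isomorphism classes of generalised Paley dessins of valency $n$ and characteristic $p$, and $GP(n,p,c)$ the subset of those with colour constant $c$. -}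

module Defs where

open import Level using (0ℓ)
open import Data.Nat as ℕ using (ℕ; zero; suc; _≤_; _<_)
open import Data.Nat.Divisibility using (_∣_)
open import Data.Nat.GCD using (gcd)
open import Data.Fin using (Fin)
open import Data.List using (List; length; filter)
open import Data.List.Base using (upTo)
open import Data.Product using (Σ; ∃; ∃-syntax; _×_; _,_; proj₁; proj₂)
open import Relation.Nullary using (¬_)
open import Relation.Binary.PropositionalEquality using (_≡_; _≢_)
open import Algebra.Structures using (IsCommutativeRing)
open import Function.Bundles using (_↔_)

φ : ℕ → ℕ
φ n = length (filter (λ k → gcd (suc k) n ℕ.≟ 1) (upTo n))

IsMultOrder : ℕ → ℕ → ℕ → Set
IsMultOrder n p d =
  (1 ≤ d) × (n ∣ (p ℕ.^ d ℕ.∸ 1)) ×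
  (∀ k → 1 ≤ k → k < d → ¬ (n ∣ (p ℕ.^ k ℕ.∸ 1)))

record Field : Set₁ where
  infixl 7 _*_
  infixl 6 _+_
  field
    Carrier : Set
    _+_ _*_ : Carrier → Carrier → Carrier
    -_      : Carrier → Carrier
    0# 1#   : Carrier
    isCommutativeRing : IsCommutativeRing _≡_ _+_ _*_ -_ 0# 1#
    0≢1     : 0# ≢ 1#
    inverse : ∀ a → a ≢ 0# → ∃[ b ] (a * b ≡ 1#)

  _^_ : Carrier → ℕ → Carrier
  a ^ zero  = 1#
  a ^ suc k = a * (a ^ k)

HasSize : Field → ℕ → Set
HasSize F q = Field.Carrier F ↔ Fin q

module Paley (F : Field) where
  open Field F

  -- (a , b) represents the map t ↦ a t + b
  Aff : Set
  Aff = Carrier × Carrier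

  -- composition of maps: (f ∘ g)(t) = f (g t)
  _∘ᵃ_ : Aff → Aff → Aff
  (a , b) ∘ᵃ (a′ , b′) = (a * a′ , a * b′ + b)

  mult : Carrier → Aff
  mult a = (a , 0#)

  HasOrder : Carrier → ℕ → Set
  HasOrder x n = (x ^ n ≡ 1#) × (∀ k → 1 ≤ k → k < n → x ^ k ≢ 1#)

  InS : Carrier → Carrier → Set
  InS x a = ∃[ k ] (a ≡ x ^ k)

  -- G_S = T ⋊ S = { t ↦ a t + b : a ∈ S }
  InG : Carrier → Aff → Set
  InG x g = InS x (proj₁ g)

  InSᵃ : Carrier → Aff → Set
  InSᵃ x g = InS x (proj₁ g) × (proj₂ g ≡ 0#)

  -- data of a generalised Paley dessin (G_S ; x , y) of valency n:
  -- x a generator of S (a subgroup of F* of order n), y ∈ G_S ∖ S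
  record GPData (n : ℕ) : Set where
    constructor gp
    field
      x    : Carrier
      y    : Aff
      ordx : HasOrder x n
      yG   : InG x y
      y∉S  : ¬ InSᵃ x y

  -- colour constant c ∈ ℤ_n : y ∈ T x^c
  HasColour : ∀ {n} → GPData n → Fin n → Set
  HasColour D c = proj₁ (GPData.y D) ≡ GPData.x D ^ Data.Fin.toℕ c

  -- isomorphism of regular dessins (G_S ; x , y) ≅ (G_S' ; x' , y'):
  -- a group isomorphism G_S → G_S' sending x ↦ x', y ↦ y'
  Iso : ∀ {n} → GPData n → GPData n → Set
  Iso D D′ =
    Σ (Aff → Aff) λ f → ( (∀ g → InG x g → InG x′ (f g))
           × (∀ g h → InG x g → InG x h → f (g ∘ᵃ h) ≡ f g ∘ᵃ f h)
           × (∀ g h → InG x g → InG x h → f g ≡ f h → g ≡ h)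
           × (∀ g′ → InG x′ g′ → ∃[ g ] (InG x g × f g ≡ g′))
           × (f (mult x) ≡ mult x′)
           × (f y ≡ y′) )
    where
      open GPData D
      open GPData D′ renaming (x to x′; y to y′)

-- "The set of ~-classes of objects satisfying P has exactly N elements":
-- there are N pairwise inequivalent representatives and every object
-- is equivalent to one of them.

ClassCount : {A : Set} → (A → Set) → (A → A → Set) → ℕ → Set
ClassCount {A} P _~_ N =
  Σ (Fin N → A) λ r →
    (∀ i → P (r i)) ×
    (∀ i j → r i ~ r j → i ≡ j) ×
    (∀ a → P a → ∃[ i ] (a ~ r i))

-- Every generalised Paley dessin (G_S ; x , y) with y = (t ↦ x^c t + b) is isomorphic, through
-- t ↦ t / b, to the normal form with y = (t ↦ x^c t + 1); more generally a Frobenius power σ induces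
-- an isomorphism onto the normal form of σ(x) with the same colour c.  Conversely, an isomorphism
-- between normal forms for x₁ and x₂ preserves the colour, and on the translations it is an additive
-- map α with α(1) = 1 and α(x₁ a) = x₂ α(a).  Such an α transports every polynomial over 𝔽_p vanishing
-- at x₁ to one vanishing at x₂, and since some nonzero one of degree ≤ d vanishes at x₁ and at its d
-- Frobenius conjugates, x₂ must be one of these conjugates.  So the classes of colour c are the
-- Frobenius orbits on the φ(n) elements of order n in F*, which is cyclic; as p has order d modulo n,
-- every orbit has exactly d elements.

module Submission where

open import Defs
open import Level using (0ℓ)
open import Function.Base using (_∘_; id)
open import Function.Bundles using (Inverse; _↔_; mk↔ₛ′)
open import Function.Definitions using (Injective)
open import Function.Properties.Inverse using (↔-refl; ↔-sym; ↔-trans)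
open import Relation.Binary.PropositionalEquality
open import Relation.Binary.Definitions using (DecidableEquality; tri<; tri≈; tri>)
open import Relation.Nullary using (¬_; Dec; yes; no)
import Relation.Nullary.Decidable as Dec
open import Relation.Nullary.Decidable using (isYes; toWitness; fromWitness; ¬?; _×-dec_; _→-dec_)
open import Relation.Unary using (Pred; Decidable)
open import Data.Empty using (⊥-elim)
open import Data.Unit using (⊤)
open import Data.Bool using (Bool; true; false; T; if_then_else_)
open import Data.Bool.Properties using (T-irrelevant)
open import Data.Sum using (inj₁; inj₂)
open import Data.Product using (Σ-syntax; ∃-syntax; _×_; _,_; proj₁; proj₂; uncurry)
open import Data.Product.Function.Dependent.Propositional using (Σ-↔)
open import Data.Product.Function.NonDependent.Propositional using (_×-↔_)
open import Data.Nat as ℕ using (ℕ; zero; suc; _∸_)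
import Data.Nat.Properties as ℕ
open import Data.Nat.Base using (_!)
open import Data.Nat.Divisibility
  using ( _∣_; _∤_; _∣?_; divides; ∣-trans; ∣-antisym; ∣1⇒≡1; ∣⇒≤; m∣m*n; n∣m*n
        ; *-monoˡ-∣; *-cancelʳ-∣; m%n≡0⇒n∣m)
open import Data.Nat.DivMod using (_/_; _%_; m/n*n≡m; m*n/n≡m; m≡m%n+[m/n]*n; m%n<n)
open import Data.Nat.GCD using (module Bézout; gcd; gcd-GCD; gcd[m,n]∣m; gcd[m,n]∣n)
open import Data.Nat.LCM using (lcm; lcm-least; gcd*lcm)
open import Data.Nat.Coprimality as Coprime
  using (Coprime; coprime⇒gcd≡1; gcd≡1⇒coprime; coprime-divisor; coprime-Bézout; prime⇒coprime)
open import Data.Nat.Primality using (Prime; prime; euclidsLemma; prime⇒nonZero; prime⇒nonTrivial; prime⇒irreducible)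
open import Data.Nat.Primality.Factorisation using (factorise)
open import Data.Nat.ListAction using (product)
open import Data.Nat.Combinatorics using (_C_; nCn≡1; nCk≡n!/k![n-k]!; k![n∸k]!∣n!)
open import Data.Nat.Induction using (<-rec)
open import Data.Fin as Fin using (Fin)
import Data.Fin.Properties as Fin
open import Data.Fin.Properties using (*↔×)
open import Data.Fin.Permutation using (Permutation; permutation; ↔⇒≡)
import Data.Vec.Functional as Vector
open import Data.List as List using (List; []; _∷_; length; filter; applyUpTo; upTo)
import Data.List.Properties as List
open import Data.List.Relation.Unary.All using (All; []; _∷_)
import Data.List.Relation.Unary.All as All
import Data.List.Relation.Unary.All.Properties as All
open import Data.List.Membership.Propositional.Properties using (∈-upTo⁺; ∈-upTo⁻)
open import Data.List.Extrema.Nat using (argmin; argmin-sel; f[argmin]≤f[xs])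
open import Algebra.Bundles using (CommutativeRing)
import Algebra.Properties.Ring as RingProperties
import Algebra.Properties.CommutativeSemigroup as CommutativeSemigroupProperties
import Algebra.Properties.Semiring.Mult as SemiringMult
import Algebra.Properties.Semiring.Exp as SemiringExp
import Algebra.Properties.CommutativeSemiring.Exp as CommutativeSemiringExp
import Algebra.Properties.CommutativeSemiring.Binomial as CommutativeSemiringBinomial
import Algebra.Properties.Monoid.Sum as MonoidSum
import Algebra.Properties.CommutativeMonoid.Sum as CommutativeMonoidSum
import Algebra.Solver.CommutativeMonoid as CommutativeMonoidSolver

Bézout-closed : (P : ℕ → Set) → (∀ {m} k → P m → P (k ℕ.* m)) →
                (∀ m n → P (m ℕ.+ n) → P n → P m) →
                ∀ {d a b} → Bézout.Identity d a b → P a → P b → P d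
Bézout-closed P multiple difference (Bézout.+- x y eq) Pa Pb =
  difference _ (y ℕ.* _) (subst P (sym eq) (multiple x Pa)) (multiple y Pb)
Bézout-closed P multiple difference (Bézout.-+ x y eq) Pa Pb =
  difference _ (x ℕ.* _) (subst P (sym eq) (multiple y Pb)) (multiple x Pa)

prime∤! : ∀ {p} → Prime p → ∀ m → m ℕ.< p → p ∤ m !
prime∤! p-prime zero    _   p∣1  = ℕ.<-irrefl (sym (∣1⇒≡1 p∣1)) (ℕ.nonTrivial⇒n>1 _ {{prime⇒nonTrivial p-prime}})
prime∤! p-prime (suc m) m<p p∣m! with euclidsLemma (suc m) (m !) p-prime p∣m!
... | inj₁ p∣1+m = ℕ.<⇒≱ m<p (∣⇒≤ p∣1+m)
... | inj₂ p∣m!′ = prime∤! p-prime m (ℕ.<-trans (ℕ.n<1+n m) m<p) p∣m!′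

n∣n! : ∀ n → .{{ℕ.NonZero n}} → n ∣ n !
n∣n! (suc n) = m∣m*n (n !)

C*k!*[n∸k]!≡n! : ∀ {n k} → k ℕ.≤ n → (n C k) ℕ.* (k ! ℕ.* (n ∸ k) !) ≡ n !
C*k!*[n∸k]!≡n! {n} {k} k≤n =
  trans (cong (ℕ._* (k ! ℕ.* (n ∸ k) !)) (nCk≡n!/k![n-k]! k≤n)) (m/n*n≡m (k![n∸k]!∣n! k≤n))
  where instance _ = k ℕ.!* (n ∸ k) !≢0

prime∣C : ∀ {p k} → Prime p → 0 ℕ.< k → k ℕ.< p → p ∣ p C k
prime∣C {p} {k} p-prime 0<k k<p with euclidsLemma (p C k) (k ! ℕ.* (p ∸ k) !) p-prime p∣p!
  where
  p∣p! : p ∣ (p C k) ℕ.* (k ! ℕ.* (p ∸ k) !)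
  p∣p! = subst (p ∣_) (sym (C*k!*[n∸k]!≡n! (ℕ.<⇒≤ k<p))) (n∣n! p {{prime⇒nonZero p-prime}})
... | inj₁ p∣C = p∣C
... | inj₂ p∣k!*[p∸k]! with euclidsLemma (k !) ((p ∸ k) !) p-prime p∣k!*[p∸k]!
...   | inj₁ p∣k!     = ⊥-elim (prime∤! p-prime k k<p p∣k!)
...   | inj₂ p∣[p∸k]! = ⊥-elim (prime∤! p-prime (p ∸ k) (ℕ.∸-monoʳ-< 0<k (ℕ.<⇒≤ k<p)) p∣[p∸k]!)

prime∤⇒coprime : ∀ {ℓ m} → Prime ℓ → ℓ ∤ m → Coprime ℓ m
prime∤⇒coprime ℓ-prime ℓ∤m (i∣ℓ , i∣m) with prime⇒irreducible ℓ-prime i∣ℓ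
... | inj₁ i≡1 = i≡1
... | inj₂ refl = ⊥-elim (ℓ∤m i∣m)

coprime-*ˡ : ∀ {a b n} → Coprime a n → Coprime b n → Coprime (a ℕ.* b) n
coprime-*ˡ {a} coprime[a,n] coprime[b,n] (i∣ab , i∣n) =
  coprime[b,n] (coprime-divisor coprime[i,a] i∣ab , i∣n)
  where
  coprime[i,a] : Coprime _ a
  coprime[i,a] (j∣i , j∣a) = coprime[a,n] (j∣a , ∣-trans j∣i i∣n)

coprime-^ˡ : ∀ {a n} → Coprime a n → ∀ k → Coprime (a ℕ.^ k) n
coprime-^ˡ coprime[a,n] zero    (i∣1 , _) = ∣1⇒≡1 i∣1
coprime-^ˡ coprime[a,n] (suc k) = coprime-*ˡ coprime[a,n] (coprime-^ˡ coprime[a,n] k)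

injective-below : ∀ {A : Set} {n} (f : ℕ → A) → (∀ {a b} → a ℕ.< b → b ℕ.< n → f a ≢ f b) →
                  ∀ {a b} → a ℕ.< n → b ℕ.< n → f a ≡ f b → a ≡ b
injective-below f strict {a} {b} a<n b<n fa≡fb with ℕ.<-cmp a b
... | tri< a<b _ _ = ⊥-elim (strict a<b b<n fa≡fb)
... | tri≈ _ a≡b _ = a≡b
... | tri> _ _ b<a = ⊥-elim (strict b<a a<n (sym fa≡fb))

coprime-∣⇒*∣ : ∀ {a b k} → Coprime a b → a ∣ k → b ∣ k → a ℕ.* b ∣ k
coprime-∣⇒*∣ {a} {b} coprime[a,b] a∣k b∣k = subst (_∣ _) lcm≡a*b (lcm-least a∣k b∣k)
  where
  lcm≡a*b : lcm a b ≡ a ℕ.* b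
  lcm≡a*b = trans (sym (ℕ.*-identityˡ (lcm a b)))
    (trans (cong (ℕ._* lcm a b) (sym (Coprime.coprime⇒gcd≡1 coprime[a,b]))) (gcd*lcm a b))

proper-divisor-of-prime-power : ∀ {ℓ} → Prime ℓ → ∀ e {h} →
                                h ∣ ℓ ℕ.^ suc e → h ℕ.< ℓ ℕ.^ suc e → h ∣ ℓ ℕ.^ e
proper-divisor-of-prime-power {ℓ} ℓ-prime e {h} h∣ℓ^[1+e] h<ℓ^[1+e] with ℓ ∣? h
... | no ℓ∤h = coprime-divisor (Coprime.sym (prime∤⇒coprime ℓ-prime ℓ∤h)) h∣ℓ^[1+e]
... | yes (divides h′ refl) = h′ℓ∣ℓ^e e h′∣ℓ^e (ℕ.*-cancelʳ-< ℓ h′ (ℓ ℕ.^ e) h′ℓ<ℓ^eℓ)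
  where
  instance _ = prime⇒nonZero ℓ-prime
  h′ℓ<ℓ^eℓ : h′ ℕ.* ℓ ℕ.< ℓ ℕ.^ e ℕ.* ℓ
  h′ℓ<ℓ^eℓ = subst (h′ ℕ.* ℓ ℕ.<_) (ℕ.*-comm ℓ (ℓ ℕ.^ e)) h<ℓ^[1+e]
  h′∣ℓ^e : h′ ∣ ℓ ℕ.^ e
  h′∣ℓ^e = *-cancelʳ-∣ ℓ (subst (h′ ℕ.* ℓ ∣_) (ℕ.*-comm ℓ (ℓ ℕ.^ e)) h∣ℓ^[1+e])
  h′ℓ∣ℓ^e : ∀ e → h′ ∣ ℓ ℕ.^ e → h′ ℕ.< ℓ ℕ.^ e → h′ ℕ.* ℓ ∣ ℓ ℕ.^ e
  h′ℓ∣ℓ^e zero     h′∣1 h′<1 = ⊥-elim (ℕ.<-irrefl (∣1⇒≡1 h′∣1) h′<1)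
  h′ℓ∣ℓ^e (suc e′) h′∣ℓ^e h′<ℓ^e = subst (h′ ℕ.* ℓ ∣_) (ℕ.*-comm (ℓ ℕ.^ e′) ℓ)
    (*-monoˡ-∣ ℓ (proper-divisor-of-prime-power ℓ-prime e′ h′∣ℓ^e h′<ℓ^e))

prime-power-split : ∀ {ℓ} → Prime ℓ → ∀ n → .{{ℕ.NonZero n}} →
                    ∃[ e ] ∃[ m ] (n ≡ ℓ ℕ.^ e ℕ.* m × ℓ ∤ m)
prime-power-split {ℓ} ℓ-prime = <-rec _ split
  where
  instance _ = prime⇒nonZero ℓ-prime
  split : ∀ n → (∀ {n′} → n′ ℕ.< n → .{{ℕ.NonZero n′}} → ∃[ e ] ∃[ m ] (n′ ≡ ℓ ℕ.^ e ℕ.* m × ℓ ∤ m)) →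
          .{{ℕ.NonZero n}} → ∃[ e ] ∃[ m ] (n ≡ ℓ ℕ.^ e ℕ.* m × ℓ ∤ m)
  split n rec with ℓ ∣? n
  ... | no ℓ∤n = 0 , n , sym (ℕ.+-identityʳ n) , ℓ∤n
  ... | yes (divides n′ refl) with rec {n′} n′<n′ℓ {{n′≢0}}
    where
    n′≢0 : ℕ.NonZero n′
    n′≢0 = ℕ.m*n≢0⇒m≢0 n′
    n′<n′ℓ : n′ ℕ.< n′ ℕ.* ℓ
    n′<n′ℓ = ℕ.m<m*n n′ ℓ {{n′≢0}} (ℕ.nonTrivial⇒n>1 ℓ {{prime⇒nonTrivial ℓ-prime}})
  ... | e , m , n′≡ℓ^e*m , ℓ∤m = suc e , m , n′ℓ≡ℓ^[1+e]*m , ℓ∤m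
    where
    n′ℓ≡ℓ^[1+e]*m : n′ ℕ.* ℓ ≡ ℓ ℕ.^ suc e ℕ.* m
    n′ℓ≡ℓ^[1+e]*m = trans (cong (ℕ._* ℓ) n′≡ℓ^e*m)
      (trans (ℕ.*-comm _ ℓ) (sym (ℕ.*-assoc ℓ (ℓ ℕ.^ e) m)))

∃-prime-divisor : ∀ n → 1 ℕ.< n → ∃[ ℓ ] (Prime ℓ × ℓ ∣ n)
∃-prime-divisor n@(suc _) 1<n with factorise n
... | record { factors = [] ; isFactorisation = refl } = ⊥-elim (ℕ.<-irrefl refl 1<n)
... | record { factors = ℓ ∷ ℓs ; isFactorisation = n≡ℓ*∏ℓs ; factorsPrime = ℓ-prime ∷ _ } =
  ℓ , ℓ-prime , divides (product ℓs) (trans n≡ℓ*∏ℓs (ℕ.*-comm ℓ (product ℓs)))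

count : ∀ {m} → (Fin m → Bool) → ℕ
count {zero}  P = 0
count {suc m} P = if P Fin.zero then suc (count (P ∘ Fin.suc)) else count (P ∘ Fin.suc)

Σ-T-≡ : ∀ {A : Set} {P : A → Bool} {a b : A} {s : T (P a)} {t : T (P b)} →
        a ≡ b → _≡_ {A = Σ[ x ∈ A ] T (P x)} (a , s) (b , t)
Σ-T-≡ {P = P} {a} {s = s} {t} refl = cong (a ,_) (T-irrelevant s t)

sucΣ : ∀ {m} {P : Fin (suc m) → Bool} → Σ[ i ∈ Fin m ] T (P (Fin.suc i)) → Σ[ i ∈ Fin (suc m) ] T (P i)
sucΣ (i , t) = Fin.suc i , t

enumerate : ∀ {m} (P : Fin m → Bool) → Fin (count P) ↔ (Σ[ i ∈ Fin m ] T (P i))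
enumerate {zero}  P = mk↔ₛ′ (λ ()) (λ { (() , _) }) (λ { (() , _) }) (λ ())
enumerate {suc m} P with P Fin.zero in P₀≡b | enumerate (P ∘ Fin.suc)
... | true  | rest = mk↔ₛ′ to from to∘from from∘to
  where
  open Inverse rest using () renaming (to to to′; from to from′; strictlyInverseˡ to to∘from′; strictlyInverseʳ to from∘to′)
  to : Fin (suc (count (P ∘ Fin.suc))) → (Σ[ i ∈ Fin (suc m) ] T (P i))
  to Fin.zero    = Fin.zero , subst T (sym P₀≡b) _
  to (Fin.suc k) = sucΣ (to′ k)
  from : Σ[ i ∈ Fin (suc m) ] T (P i) → Fin (suc (count (P ∘ Fin.suc)))
  from (Fin.zero  , _) = Fin.zero
  from (Fin.suc i , t) = Fin.suc (from′ (i , t))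
  to∘from : ∀ y → to (from y) ≡ y
  to∘from (Fin.zero  , t) = cong (Fin.zero ,_) (T-irrelevant _ t)
  to∘from (Fin.suc i , t) = cong (sucΣ) (to∘from′ (i , t))
  from∘to : ∀ k → from (to k) ≡ k
  from∘to Fin.zero    = refl
  from∘to (Fin.suc k) = cong Fin.suc (from∘to′ k)
... | false | rest = mk↔ₛ′ to from to∘from from∘to
  where
  open Inverse rest using () renaming (to to to′; from to from′; strictlyInverseˡ to to∘from′; strictlyInverseʳ to from∘to′)
  to : Fin (count (P ∘ Fin.suc)) → (Σ[ i ∈ Fin (suc m) ] T (P i))
  to k = sucΣ (to′ k)
  from : Σ[ i ∈ Fin (suc m) ] T (P i) → Fin (count (P ∘ Fin.suc))
  from (Fin.zero  , t) = ⊥-elim (subst T P₀≡b t)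
  from (Fin.suc i , t) = from′ (i , t)
  to∘from : ∀ y → to (from y) ≡ y
  to∘from (Fin.zero  , t) = ⊥-elim (subst T P₀≡b t)
  to∘from (Fin.suc i , t) = cong (sucΣ) (to∘from′ (i , t))
  from∘to : ∀ k → from (to k) ≡ k
  from∘to = from∘to′

length-filter-applyUpTo : ∀ {P : Pred ℕ 0ℓ} (P? : Decidable P) m f →
  length (filter P? (applyUpTo f m)) ≡ count (λ (k : Fin m) → isYes (P? (f (Fin.toℕ k))))
length-filter-applyUpTo P? zero    f = refl
length-filter-applyUpTo P? (suc m) f with P? (f 0)
... | yes _ = cong suc (length-filter-applyUpTo P? m (f ∘ suc))
... | no  _ = length-filter-applyUpTo P? m (f ∘ suc)

funToFin-cong : ∀ {m n} {f g : Fin m → Fin n} → (∀ i → f i ≡ g i) → Fin.funToFin f ≡ Fin.funToFin g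
funToFin-cong {zero}  f≗g = refl
funToFin-cong {suc m} f≗g = cong₂ Fin.combine (f≗g Fin.zero) (funToFin-cong (f≗g ∘ Fin.suc))

∷-injective : ∀ {A : Set} {m} (x : A) (f : ℕ → A) → (∀ {i j} → i ℕ.< m → j ℕ.< m → f i ≡ f j → i ≡ j) →
              ¬ (∃[ k ] (k ℕ.< m × x ≡ f k)) → Injective _≡_ _≡_ (x Vector.∷ λ (i : Fin m) → f (Fin.toℕ i))
∷-injective x f f-injective x∉f {Fin.zero}  {Fin.zero}  _     = refl
∷-injective x f f-injective x∉f {Fin.zero}  {Fin.suc j} x≡fj  = ⊥-elim (x∉f (Fin.toℕ j , Fin.toℕ<n j , x≡fj))
∷-injective x f f-injective x∉f {Fin.suc i} {Fin.zero}  fi≡x  = ⊥-elim (x∉f (Fin.toℕ i , Fin.toℕ<n i , sym fi≡x))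
∷-injective x f f-injective x∉f {Fin.suc i} {Fin.suc j} fi≡fj =
  cong Fin.suc (Fin.toℕ-injective (f-injective (Fin.toℕ<n i) (Fin.toℕ<n j) fi≡fj))

module FieldProperties (F : Field) where
  open Field F public

  commutativeRing : CommutativeRing 0ℓ 0ℓ
  commutativeRing = record { isCommutativeRing = isCommutativeRing }

  open CommutativeRing commutativeRing public
    using ( +-comm; *-assoc; *-comm; +-identityˡ; +-identityʳ; *-identityˡ; *-identityʳ
          ; -‿inverseˡ; -‿inverseʳ; distribˡ; distribʳ; zeroˡ; zeroʳ; _-_
          ; ring; semiring; commutativeSemiring; +-commutativeSemigroup; *-commutativeSemigroup
          ; +-commutativeMonoid; *-commutativeMonoid; +-monoid)
  open RingProperties ring public
    using ( -0#≈0#; +-cancelˡ; +-cancelʳ; x∙y⁻¹≈ε⇒x≈y; //-rightDividesˡ; //-rightDividesʳ; +-identityʳ-unique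
          ; x+x≈x⇒x≈0; +-inverseʳ-unique; -‿+-comm; x[y-z]≈xy-xz)
  open CommutativeSemigroupProperties +-commutativeSemigroup public
    using () renaming (interchange to +-interchange)
  open CommutativeSemigroupProperties *-commutativeSemigroup public
    using () renaming (x∙yz≈y∙xz to *-x∙yz≈y∙xz)
  open SemiringMult semiring using (×-homo-+; ×1-homo-*; ×-assoc-*)
  open SemiringMult semiring public using () renaming (_×_ to _·_)
  open SemiringExp semiring public using () renaming (_^_ to _^ᵉ_)
  open SemiringExp semiring using (^-homo-*; ^-assocʳ)
  open CommutativeSemiringExp commutativeSemiring using (^-distrib-*)

  ^≡^ᵉ : ∀ x k → x ^ k ≡ x ^ᵉ k
  ^≡^ᵉ x zero = refl
  ^≡^ᵉ x (suc k) = cong (x *_) (^≡^ᵉ x k)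

  ^-homo-+ : ∀ x m n → x ^ (m ℕ.+ n) ≡ x ^ m * x ^ n
  ^-homo-+ x m n rewrite ^≡^ᵉ x (m ℕ.+ n) | ^≡^ᵉ x m | ^≡^ᵉ x n = ^-homo-* x m n

  ^-*-assoc : ∀ x m n → (x ^ m) ^ n ≡ x ^ (m ℕ.* n)
  ^-*-assoc x m n rewrite ^≡^ᵉ (x ^ m) n | ^≡^ᵉ x m | ^≡^ᵉ x (m ℕ.* n) = ^-assocʳ x m n

  ^-distribʳ-* : ∀ x y n → (x * y) ^ n ≡ x ^ n * y ^ n
  ^-distribʳ-* x y n rewrite ^≡^ᵉ (x * y) n | ^≡^ᵉ x n | ^≡^ᵉ y n = ^-distrib-* x y n

  ^-comm : ∀ x m n → (x ^ m) ^ n ≡ (x ^ n) ^ m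
  ^-comm x m n = trans (^-*-assoc x m n) (trans (cong (x ^_) (ℕ.*-comm m n)) (sym (^-*-assoc x n m)))

  1^n≡1 : ∀ n → 1# ^ n ≡ 1#
  1^n≡1 zero = refl
  1^n≡1 (suc n) = trans (*-identityˡ _) (1^n≡1 n)

  0^n≡0 : ∀ n → .{{ℕ.NonZero n}} → 0# ^ n ≡ 0#
  0^n≡0 (suc n) = zeroˡ _

  1≢0 : 1# ≢ 0#
  1≢0 1≡0 = 0≢1 (sym 1≡0)

  *-cancelˡ : ∀ {a b c} → a ≢ 0# → a * b ≡ a * c → b ≡ c
  *-cancelˡ {a} {b} {c} a≢0 ab≡ac with inverse a a≢0
  ... | a⁻¹ , aa⁻¹≡1 = begin
    b                ≡⟨ sym (*-identityˡ b) ⟩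
    1# * b           ≡⟨ cong (_* b) (trans (sym aa⁻¹≡1) (*-comm a a⁻¹)) ⟩
    (a⁻¹ * a) * b    ≡⟨ *-assoc a⁻¹ a b ⟩
    a⁻¹ * (a * b)    ≡⟨ cong (a⁻¹ *_) ab≡ac ⟩
    a⁻¹ * (a * c)    ≡⟨ sym (*-assoc a⁻¹ a c) ⟩
    (a⁻¹ * a) * c    ≡⟨ cong (_* c) (trans (*-comm a⁻¹ a) aa⁻¹≡1) ⟩
    1# * c           ≡⟨ *-identityˡ c ⟩
    c                ∎
    where open ≡-Reasoning

  *-cancelʳ : ∀ {a b c} → a ≢ 0# → b * a ≡ c * a → b ≡ c
  *-cancelʳ {a} {b} {c} a≢0 ba≡ca = *-cancelˡ a≢0 (trans (*-comm a b) (trans ba≡ca (*-comm c a)))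

  *≢0 : ∀ {a b} → a ≢ 0# → b ≢ 0# → a * b ≢ 0#
  *≢0 {a} a≢0 b≢0 ab≡0 = b≢0 (*-cancelˡ a≢0 (trans ab≡0 (sym (zeroʳ a))))

  inverse≢0 : ∀ {a} (a≢0 : a ≢ 0#) → proj₁ (inverse a a≢0) ≢ 0#
  inverse≢0 {a} a≢0 a⁻¹≡0 = 1≢0 (trans (sym (proj₂ (inverse a a≢0))) (trans (cong (a *_) a⁻¹≡0) (zeroʳ a)))

  ^≢0 : ∀ {a} k → a ≢ 0# → a ^ k ≢ 0#
  ^≢0 zero a≢0 = 1≢0
  ^≢0 (suc k) a≢0 = *≢0 a≢0 (^≢0 k a≢0)

  ι : ℕ → Carrier
  ι n = n · 1#

  ι-homo-+ : ∀ m n → ι (m ℕ.+ n) ≡ ι m + ι n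
  ι-homo-+ m n = ×-homo-+ 1# m n

  ι-homo-* : ∀ m n → ι (m ℕ.* n) ≡ ι m * ι n
  ι-homo-* = ×1-homo-*

  ·≡ι* : ∀ n a → n · a ≡ ι n * a
  ·≡ι* n a = trans (cong (n ·_) (sym (*-identityˡ a))) (sym (×-assoc-* n 1# a))

  ι-homo-^ : ∀ m k → ι (m ℕ.^ k) ≡ ι m ^ k
  ι-homo-^ m zero = +-identityʳ 1#
  ι-homo-^ m (suc k) = trans (ι-homo-* m (m ℕ.^ k)) (cong (ι m *_) (ι-homo-^ m k))

  ι[k*m]≡0 : ∀ {m} k → ι m ≡ 0# → ι (k ℕ.* m) ≡ 0#
  ι[k*m]≡0 {m} k ιm≡0 = trans (ι-homo-* k m) (trans (cong (ι k *_) ιm≡0) (zeroʳ (ι k)))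

  ι-gcd≡0 : ∀ {d a b} → Bézout.Identity d a b → ι a ≡ 0# → ι b ≡ 0# → ι d ≡ 0#
  ι-gcd≡0 = Bézout-closed (λ k → ι k ≡ 0#) ι[k*m]≡0 difference
    where
    difference : ∀ m n → ι (m ℕ.+ n) ≡ 0# → ι n ≡ 0# → ι m ≡ 0#
    difference m n ιm+n≡0 ιn≡0 =
      trans (sym (+-identityʳ (ι m))) (trans (cong (ι m +_) (sym ιn≡0)) (trans (sym (ι-homo-+ m n)) ιm+n≡0))

  ^[k*m]≡1 : ∀ {u m} k → u ^ m ≡ 1# → u ^ (k ℕ.* m) ≡ 1#
  ^[k*m]≡1 {u} {m} k um≡1 = begin
    u ^ (k ℕ.* m) ≡⟨ cong (u ^_) (ℕ.*-comm k m) ⟩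
    u ^ (m ℕ.* k) ≡⟨ sym (^-*-assoc u m k) ⟩
    (u ^ m) ^ k   ≡⟨ cong (_^ k) um≡1 ⟩
    1# ^ k        ≡⟨ 1^n≡1 k ⟩
    1#            ∎
    where open ≡-Reasoning

  ^-gcd≡1 : ∀ u {d a b} → Bézout.Identity d a b → u ^ a ≡ 1# → u ^ b ≡ 1# → u ^ d ≡ 1#
  ^-gcd≡1 u = Bézout-closed (λ k → u ^ k ≡ 1#) ^[k*m]≡1 difference
    where
    difference : ∀ m n → u ^ (m ℕ.+ n) ≡ 1# → u ^ n ≡ 1# → u ^ m ≡ 1#
    difference m n um+n≡1 un≡1 =
      trans (sym (*-identityʳ (u ^ m))) (trans (cong (u ^ m *_) (sym un≡1)) (trans (sym (^-homo-+ u m n)) um+n≡1))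

  [a-b]+[c-d]≡[a+c]-[b+d] : ∀ a b c d → (a - b) + (c - d) ≡ (a + c) - (b + d)
  [a-b]+[c-d]≡[a+c]-[b+d] a b c d = trans (+-interchange a (- b) c (- d)) (cong ((a + c) +_) (-‿+-comm b d))

  record IsUnitalAdditive (σ : Carrier → Carrier) : Set where
    field
      +-homo  : ∀ a b → σ (a + b) ≡ σ a + σ b
      1#-homo : σ 1# ≡ 1#

    0#-homo : σ 0# ≡ 0#
    0#-homo = x+x≈x⇒x≈0 (σ 0#) (trans (sym (+-homo 0# 0#)) (cong σ (+-identityʳ 0#)))

    -‿homo : ∀ a → σ (- a) ≡ - σ a
    -‿homo a = +-inverseʳ-unique (σ a) (σ (- a)) (trans (sym (+-homo a (- a))) (trans (cong σ (-‿inverseʳ a)) 0#-homo))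

    ι-fixed : ∀ k → σ (ι k) ≡ ι k
    ι-fixed zero    = 0#-homo
    ι-fixed (suc k) = trans (+-homo 1# (ι k)) (cong₂ _+_ 1#-homo (ι-fixed k))

    ι-difference-fixed : ∀ a b → σ (ι a - ι b) ≡ ι a - ι b
    ι-difference-fixed a b = trans (+-homo (ι a) (- ι b)) (cong₂ _+_ (ι-fixed a) (trans (-‿homo (ι b)) (cong -_ (ι-fixed b))))

  -- Binomial theorem; the coefficients p C k with 0 < k < p vanish.
  freshman's-dream : ∀ {p} → Prime p → ι p ≡ 0# → ∀ a b → (a + b) ^ p ≡ a ^ p + b ^ p
  freshman's-dream {zero} (prime {{()}} _)
  freshman's-dream {suc p-1} p-prime ι[p]≡0 a b = begin
    (a + b) ^ suc p-1                              ≡⟨ ^≡^ᵉ (a + b) (suc p-1) ⟩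
    (a + b) ^ᵉ suc p-1                             ≡⟨ binomial-theorem (suc p-1) a b ⟩
    term Fin.zero + ∑ (term ∘ Fin.suc)             ≡⟨ cong (term Fin.zero +_) (sum-init-last (term ∘ Fin.suc)) ⟩
    term Fin.zero + (∑ (term ∘ Fin.suc ∘ Fin.inject₁) + term (Fin.suc (Fin.fromℕ p-1)))
      ≡⟨ cong (λ v → term Fin.zero + (v + term (Fin.suc (Fin.fromℕ p-1)))) (trans (sum-cong-≗ middle) (sum-replicate-zero p-1)) ⟩
    term Fin.zero + (0# + term (Fin.suc (Fin.fromℕ p-1)))  ≡⟨ cong₂ (λ u v → u + (0# + v)) first last ⟩
    b ^ suc p-1 + (0# + a ^ suc p-1)               ≡⟨ trans (cong (b ^ suc p-1 +_) (+-identityˡ _)) (+-comm _ _) ⟩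
    a ^ suc p-1 + b ^ suc p-1                      ∎
    where
    open ≡-Reasoning
    open CommutativeSemiringBinomial commutativeSemiring using () renaming (theorem to binomial-theorem)
    open MonoidSum +-monoid using (sum-init-last; sum-cong-≗; sum-replicate-zero) renaming (sum to ∑)
    term : Fin (suc (suc p-1)) → Carrier
    term k = (suc p-1 C Fin.toℕ k) · (a ^ᵉ Fin.toℕ k * b ^ᵉ (suc p-1 ∸ Fin.toℕ k))
    first : term Fin.zero ≡ b ^ suc p-1
    first = trans (+-identityʳ _) (trans (*-identityˡ _) (sym (^≡^ᵉ b (suc p-1))))
    last : term (Fin.suc (Fin.fromℕ p-1)) ≡ a ^ suc p-1
    last rewrite Fin.toℕ-fromℕ p-1 | nCn≡1 (suc p-1) | ℕ.n∸n≡0 p-1 =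
      trans (+-identityʳ _) (trans (*-identityʳ _) (sym (^≡^ᵉ a (suc p-1))))
    middle : ∀ i → term (Fin.suc (Fin.inject₁ i)) ≡ 0#
    middle i with prime∣C p-prime (ℕ.s≤s ℕ.z≤n) (ℕ.s≤s (subst (ℕ._< p-1) (sym (Fin.toℕ-inject₁ i)) (Fin.toℕ<n i)))
    ... | divides m C≡m*p = begin
      (suc p-1 C k) · z  ≡⟨ ·≡ι* (suc p-1 C k) z ⟩
      ι (suc p-1 C k) * z ≡⟨ cong (λ c → ι c * z) C≡m*p ⟩
      ι (m ℕ.* suc p-1) * z ≡⟨ cong (_* z) (ι[k*m]≡0 m ι[p]≡0) ⟩
      0# * z              ≡⟨ zeroˡ z ⟩
      0#                  ∎
      where
      k = Fin.toℕ (Fin.suc (Fin.inject₁ i))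
      z = a ^ᵉ k * b ^ᵉ (suc p-1 ∸ k)

module Polynomial (F : Field) where
  open FieldProperties F
  open CommutativeMonoidSolver +-commutativeMonoid using (solve; _⊕_; _⊜_)

  eval : List Carrier → Carrier → Carrier
  eval []      x = 0#
  eval (a ∷ P) x = a + x * eval P x

  IsZero : List Carrier → Set
  IsZero = All (_≡ 0#)

  quot : List Carrier → Carrier → List Carrier
  quot []          r = []
  quot (a ∷ [])    r = []
  quot (a ∷ b ∷ P) r = eval (b ∷ P) r ∷ quot (b ∷ P) r

  synthetic-division-step : ∀ a x r Q A →
    a + x * ((x - r) * Q + A) ≡ (x - r) * (A + x * Q) + (a + r * A)
  synthetic-division-step a x r Q A = begin
    a + x * ((x - r) * Q + A)                          ≡⟨ cong (a +_) (distribˡ x _ A) ⟩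
    a + (x * ((x - r) * Q) + x * A)                    ≡⟨ cong (a +_) (cong₂ _+_ (*-x∙yz≈y∙xz x (x - r) Q) xA) ⟩
    a + ((x - r) * (x * Q) + ((x - r) * A + r * A))    ≡⟨ solve 4 (λ a u v w → a ⊕ (u ⊕ (v ⊕ w)) ⊜ (v ⊕ u) ⊕ (a ⊕ w)) refl a _ _ _ ⟩
    ((x - r) * A + (x - r) * (x * Q)) + (a + r * A)    ≡⟨ cong (_+ (a + r * A)) (sym (distribˡ (x - r) A (x * Q))) ⟩
    (x - r) * (A + x * Q) + (a + r * A)                ∎
    where
    open ≡-Reasoning
    xA : x * A ≡ (x - r) * A + r * A
    xA = trans (cong (_* A) (sym (//-rightDividesˡ r x))) (distribʳ A (x - r) r)

  eval-quot : ∀ P r x → eval P x ≡ (x - r) * eval (quot P r) x + eval P r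
  eval-quot []          r x = sym (trans (cong (_+ 0#) (zeroʳ (x - r))) (+-identityʳ 0#))
  eval-quot (a ∷ [])    r x = begin
    a + x * 0#               ≡⟨ cong (a +_) (trans (zeroʳ x) (sym (zeroʳ r))) ⟩
    a + r * 0#               ≡⟨ sym (+-identityˡ _) ⟩
    0# + (a + r * 0#)        ≡⟨ cong (_+ (a + r * 0#)) (sym (zeroʳ (x - r))) ⟩
    (x - r) * 0# + (a + r * 0#) ∎
    where open ≡-Reasoning
  eval-quot (a ∷ b ∷ P) r x =
    trans (cong (λ v → a + x * v) (eval-quot (b ∷ P) r x))
          (synthetic-division-step a x r (eval (quot (b ∷ P) r) x) (eval (b ∷ P) r))

  length-quot : ∀ a P r → length (quot (a ∷ P) r) ≡ length P
  length-quot a []      r = refl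
  length-quot a (b ∷ P) r = cong suc (length-quot b P r)

  quot-isZero : ∀ P r → IsZero (quot P r) → eval P r ≡ 0# → IsZero P
  quot-isZero []          r _            _       = []
  quot-isZero (a ∷ [])    r _            Pr≡0    = trans (sym (trans (cong (a +_) (zeroʳ r)) (+-identityʳ a))) Pr≡0 ∷ []
  quot-isZero (a ∷ b ∷ P) r (Br≡0 ∷ Q≡0) Pr≡0    = a≡0 ∷ quot-isZero (b ∷ P) r Q≡0 Br≡0
    where
    a≡0 : a ≡ 0#
    a≡0 = trans (sym (trans (cong (λ v → a + r * v) Br≡0) (trans (cong (a +_) (zeroʳ r)) (+-identityʳ a)))) Pr≡0

  root-bound : ∀ m P → ¬ IsZero P → (ρ : Fin m → Carrier) → Injective _≡_ _≡_ ρ →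
               (∀ i → eval P (ρ i) ≡ 0#) → m ℕ.< length P
  root-bound m       []      P≢0 ρ ρ-inj roots = ⊥-elim (P≢0 [])
  root-bound zero    (a ∷ P) P≢0 ρ ρ-inj roots = ℕ.s≤s ℕ.z≤n
  root-bound (suc m) (a ∷ P) P≢0 ρ ρ-inj roots =
    subst (λ l → suc m ℕ.< suc l) (length-quot a P r)
      (ℕ.s≤s (root-bound m Q Q≢0 (ρ ∘ Fin.suc) (Fin.suc-injective ∘ ρ-inj) Q-roots))
    where
    r = ρ Fin.zero
    Q = quot (a ∷ P) r
    Q≢0 : ¬ IsZero Q
    Q≢0 Q≡0 = P≢0 (quot-isZero (a ∷ P) r Q≡0 (roots Fin.zero))
    Q-roots : ∀ i → eval Q (ρ (Fin.suc i)) ≡ 0#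
    Q-roots i = *-cancelˡ x-r≢0 (begin
      (x - r) * eval Q x                 ≡⟨ sym (+-identityʳ _) ⟩
      (x - r) * eval Q x + 0#            ≡⟨ cong ((x - r) * eval Q x +_) (sym (roots Fin.zero)) ⟩
      (x - r) * eval Q x + eval (a ∷ P) r ≡⟨ sym (eval-quot (a ∷ P) r x) ⟩
      eval (a ∷ P) x                     ≡⟨ roots (Fin.suc i) ⟩
      0#                                 ≡⟨ sym (zeroʳ (x - r)) ⟩
      (x - r) * 0#                       ∎)
      where
      open ≡-Reasoning
      x = ρ (Fin.suc i)
      x-r≢0 : x - r ≢ 0#
      x-r≢0 x-r≡0 with ρ-inj (x∙y⁻¹≈ε⇒x≈y x r x-r≡0)
      ... | ()

  Xⁿ : ℕ → List Carrier
  Xⁿ zero    = 1# ∷ []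
  Xⁿ (suc n) = 0# ∷ Xⁿ n

  eval-Xⁿ : ∀ n x → eval (Xⁿ n) x ≡ x ^ n
  eval-Xⁿ zero    x = trans (cong (1# +_) (zeroʳ x)) (+-identityʳ 1#)
  eval-Xⁿ (suc n) x = trans (+-identityˡ _) (cong (x *_) (eval-Xⁿ n x))

  Xⁿ≢0 : ∀ n → ¬ IsZero (Xⁿ n)
  Xⁿ≢0 zero    (1≡0 ∷ _)   = 1≢0 1≡0
  Xⁿ≢0 (suc n) (_ ∷ Xⁿ≡0) = Xⁿ≢0 n Xⁿ≡0

  length-Xⁿ : ∀ n → length (Xⁿ n) ≡ suc n
  length-Xⁿ zero    = refl
  length-Xⁿ (suc n) = cong suc (length-Xⁿ n)

  #roots-of-^≤ : ∀ {m} n → .{{ℕ.NonZero n}} → ∀ c (ρ : Fin m → Carrier) → Injective _≡_ _≡_ ρ →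
                 (∀ i → ρ i ^ n ≡ c) → m ℕ.≤ n
  #roots-of-^≤ {m} (suc n) c ρ ρ-inj ρⁿ≡c =
    ℕ.≤-pred (subst (m ℕ.<_) (cong suc (length-Xⁿ n)) (root-bound m (- c ∷ Xⁿ n) P≢0 ρ ρ-inj roots))
    where
    P≢0 : ¬ IsZero (- c ∷ Xⁿ n)
    P≢0 (_ ∷ Xⁿ≡0) = Xⁿ≢0 n Xⁿ≡0
    roots : ∀ i → eval (- c ∷ Xⁿ n) (ρ i) ≡ 0#
    roots i = begin
      - c + ρ i * eval (Xⁿ n) (ρ i) ≡⟨ cong (λ v → - c + ρ i * v) (eval-Xⁿ n (ρ i)) ⟩
      - c + ρ i ^ suc n             ≡⟨ cong (- c +_) (ρⁿ≡c i) ⟩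
      - c + c                       ≡⟨ -‿inverseˡ c ⟩
      0#                            ∎
      where open ≡-Reasoning

  eval-homo : ∀ {σ} → IsUnitalAdditive σ → ∀ {x y} → (∀ a → σ (x * a) ≡ y * σ a) →
              ∀ P → All (λ c → σ c ≡ c) P → σ (eval P x) ≡ eval P y
  eval-homo σ-homo σ-x []      []          = IsUnitalAdditive.0#-homo σ-homo
  eval-homo {σ} σ-homo {x} {y} σ-x (c ∷ P) (σc≡c ∷ σP≡P) = begin
    σ (c + x * eval P x)       ≡⟨ IsUnitalAdditive.+-homo σ-homo c _ ⟩
    σ c + σ (x * eval P x)     ≡⟨ cong₂ _+_ σc≡c (σ-x (eval P x)) ⟩
    c + y * σ (eval P x)       ≡⟨ cong (λ v → c + y * v) (eval-homo σ-homo σ-x P σP≡P) ⟩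
    c + y * eval P y           ∎
    where open ≡-Reasoning

  eval-tabulate-difference : ∀ {m} (f g : Fin m → Carrier) x →
    eval (List.tabulate (λ i → f i - g i)) x ≡ eval (List.tabulate f) x - eval (List.tabulate g) x
  eval-tabulate-difference {zero}  f g x = sym (trans (cong (0# +_) -0#≈0#) (+-identityʳ 0#))
  eval-tabulate-difference {suc m} f g x = begin
    (f₀ - g₀) + x * eval (List.tabulate (λ i → f (Fin.suc i) - g (Fin.suc i))) x
      ≡⟨ cong (λ v → (f₀ - g₀) + x * v) (eval-tabulate-difference (f ∘ Fin.suc) (g ∘ Fin.suc) x) ⟩
    (f₀ - g₀) + x * (F′ - G′)           ≡⟨ cong ((f₀ - g₀) +_) (x[y-z]≈xy-xz x F′ G′) ⟩
    (f₀ - g₀) + (x * F′ - x * G′)       ≡⟨ [a-b]+[c-d]≡[a+c]-[b+d] f₀ g₀ (x * F′) (x * G′) ⟩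
    (f₀ + x * F′) - (g₀ + x * G′)       ∎
    where
    open ≡-Reasoning
    f₀ = f Fin.zero
    g₀ = g Fin.zero
    F′ = eval (List.tabulate (f ∘ Fin.suc)) x
    G′ = eval (List.tabulate (g ∘ Fin.suc)) x

module FiniteField (F : Field) {q-1 : ℕ} (size : HasSize F (suc q-1)) where
  open FieldProperties F
  open Inverse size public using (to; from)
  open Inverse size using (strictlyInverseˡ; strictlyInverseʳ)

  q : ℕ
  q = suc q-1

  to-injective : Injective _≡_ _≡_ to
  to-injective {a} {b} to[a]≡to[b] =
    trans (sym (strictlyInverseʳ a)) (trans (cong from to[a]≡to[b]) (strictlyInverseʳ b))

  infix 4 _≟_
  _≟_ : DecidableEquality Carrier
  a ≟ b = Dec.map′ to-injective (cong to) (to a Fin.≟ to b)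

  enumerate-Carrier : (P : Carrier → Bool) → Fin (count (P ∘ from)) ↔ (Σ[ a ∈ Carrier ] T (P a))
  enumerate-Carrier P = ↔-trans (enumerate (P ∘ from)) (Σ-↔ (↔-sym size) ↔-refl)

  -- Translation by 1 permutes F, so Σ a = Σ (a + 1) = Σ a + q·1.
  ι[q]≡0 : ι q ≡ 0#
  ι[q]≡0 = +-identityʳ-unique (sum from) (ι q) (sym shifted)
    where
    open CommutativeMonoidSum +-commutativeMonoid using (sum; sum-permute; sum-cong-≗; ∑-distrib-+; sum-replicate)
    shift : Permutation q q
    shift = permutation (λ i → to (from i + 1#)) (λ i → to (from i - 1#))
      (λ i → trans (cong (λ a → to (a + 1#)) (strictlyInverseʳ _))
                   (trans (cong to (//-rightDividesˡ 1# (from i))) (strictlyInverseˡ i)))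
      (λ i → trans (cong (λ a → to (a - 1#)) (strictlyInverseʳ _))
                   (trans (cong to (//-rightDividesʳ 1# (from i))) (strictlyInverseˡ i)))
    shifted : sum from ≡ sum from + ι q
    shifted = begin
      sum from                                 ≡⟨ sum-permute from shift ⟩
      sum {q} (λ i → from (to (from i + 1#)))  ≡⟨ sum-cong-≗ {q} (λ i → strictlyInverseʳ (from i + 1#)) ⟩
      sum {q} (λ i → from i + 1#)              ≡⟨ ∑-distrib-+ from (λ _ → 1#) ⟩
      sum from + sum {q} (λ _ → 1#)            ≡⟨ cong (sum from +_) (sum-replicate q) ⟩
      sum from + ι q                           ∎
      where open ≡-Reasoning

  nonzero : Fin q-1 → Carrier
  nonzero i = from (Fin.punchIn (to 0#) i)

  nonzero≢0 : ∀ i → nonzero i ≢ 0#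
  nonzero≢0 i nonzero[i]≡0 =
    Fin.punchInᵢ≢i (to 0#) i (trans (sym (strictlyInverseˡ _)) (cong to nonzero[i]≡0))

  nonzero-injective : Injective _≡_ _≡_ nonzero
  nonzero-injective {i} {j} eq = Fin.punchIn-injective (to 0#) i j
    (trans (sym (strictlyInverseˡ _)) (trans (cong to eq) (strictlyInverseˡ _)))

  nonzero⁻¹ : ∀ a → a ≢ 0# → Fin q-1
  nonzero⁻¹ a a≢0 = Fin.punchOut {i = to 0#} {j = to a} (λ to0≡toa → a≢0 (to-injective (sym to0≡toa)))

  nonzero∘nonzero⁻¹ : ∀ a (a≢0 : a ≢ 0#) → nonzero (nonzero⁻¹ a a≢0) ≡ a
  nonzero∘nonzero⁻¹ a a≢0 = trans (cong from (Fin.punchIn-punchOut _)) (strictlyInverseʳ a)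

  nonzero⁻¹-cong : ∀ {a b} (a≢0 : a ≢ 0#) (b≢0 : b ≢ 0#) → a ≡ b → nonzero⁻¹ a a≢0 ≡ nonzero⁻¹ b b≢0
  nonzero⁻¹-cong a≢0 b≢0 refl = Fin.punchOut-cong (to 0#) refl

  nonzero⁻¹∘nonzero : ∀ i (h : nonzero i ≢ 0#) → nonzero⁻¹ (nonzero i) h ≡ i
  nonzero⁻¹∘nonzero i h = trans (Fin.punchOut-cong′ (to 0#) (strictlyInverseˡ _)) (Fin.punchOut-punchIn (to 0#))

  1≤q-1 : 1 ℕ.≤ q-1
  1≤q-1 = ℕ.>-nonZero⁻¹ q-1 {{Fin.nonZeroIndex (nonzero⁻¹ 1# 1≢0)}}

  scale : ∀ {c} → c ≢ 0# → Fin q-1 → Fin q-1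
  scale {c} c≢0 i = nonzero⁻¹ (c * nonzero i) (*≢0 c≢0 (nonzero≢0 i))

  nonzero-scale : ∀ {c} (c≢0 : c ≢ 0#) i → nonzero (scale c≢0 i) ≡ c * nonzero i
  nonzero-scale c≢0 i = nonzero∘nonzero⁻¹ _ (*≢0 c≢0 (nonzero≢0 i))

  scale-inverse : ∀ {b c} (b≢0 : b ≢ 0#) (c≢0 : c ≢ 0#) → b * c ≡ 1# → ∀ i → scale b≢0 (scale c≢0 i) ≡ i
  scale-inverse {b} {c} b≢0 c≢0 bc≡1 i =
    trans (nonzero⁻¹-cong (*≢0 b≢0 (nonzero≢0 _)) (nonzero≢0 i) bcx≡x) (nonzero⁻¹∘nonzero i (nonzero≢0 i))
    where
    bcx≡x : b * nonzero (scale c≢0 i) ≡ nonzero i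
    bcx≡x = begin
      b * nonzero (scale c≢0 i) ≡⟨ cong (b *_) (nonzero-scale c≢0 i) ⟩
      b * (c * nonzero i)       ≡⟨ sym (*-assoc b c _) ⟩
      (b * c) * nonzero i       ≡⟨ cong (_* nonzero i) bc≡1 ⟩
      1# * nonzero i            ≡⟨ *-identityˡ _ ⟩
      nonzero i                 ∎
      where open ≡-Reasoning

  scaling : ∀ {a} → a ≢ 0# → Permutation q-1 q-1
  scaling {a} a≢0 = permutation (scale a≢0) (scale (inverse≢0 a≢0))
    (scale-inverse a≢0 (inverse≢0 a≢0) aa⁻¹≡1) (scale-inverse (inverse≢0 a≢0) a≢0 (trans (*-comm _ a) aa⁻¹≡1))
    where aa⁻¹≡1 = proj₂ (inverse a a≢0)

  -- Multiplication by a permutes the nonzero elements, so Π b = Π (a b) = a^(q-1) Π b.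
  fermat : ∀ a → a ≢ 0# → a ^ q-1 ≡ 1#
  fermat a a≢0 = *-cancelʳ (∏≢0 nonzero nonzero≢0) (begin
    a ^ q-1 * ∏ nonzero                    ≡⟨ cong (_* ∏ nonzero) (trans (^≡^ᵉ a q-1) (sym (sum-replicate q-1))) ⟩
    ∏ {q-1} (λ _ → a) * ∏ nonzero          ≡⟨ sym (∑-distrib-+ (λ _ → a) nonzero) ⟩
    ∏ {q-1} (λ i → a * nonzero i)          ≡⟨ sym (sum-cong-≗ {q-1} (nonzero-scale a≢0)) ⟩
    ∏ {q-1} (λ i → nonzero (scale a≢0 i))  ≡⟨ sym (sum-permute nonzero (scaling a≢0)) ⟩
    ∏ nonzero                              ≡⟨ sym (*-identityˡ _) ⟩
    1# * ∏ nonzero                         ∎)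
    where
    open ≡-Reasoning
    open CommutativeMonoidSum *-commutativeMonoid using (sum-permute; sum-cong-≗; ∑-distrib-+; sum-replicate)
      renaming (sum to ∏)
    ∏≢0 : ∀ {m} (f : Fin m → Carrier) → (∀ i → f i ≢ 0#) → ∏ f ≢ 0#
    ∏≢0 {zero}  f f≢0 = 1≢0
    ∏≢0 {suc m} f f≢0 = *≢0 (f≢0 Fin.zero) (∏≢0 (f ∘ Fin.suc) (f≢0 ∘ Fin.suc))

module Frobenius (F : Field) {p d : ℕ} (p-prime : Prime p) (size : HasSize F (p ℕ.^ d)) where
  open FieldProperties F
  open Polynomial F using (eval; IsZero; eval-tabulate-difference)

  private instance
    p≢0 : ℕ.NonZero p
    p≢0 = prime⇒nonZero p-prime

  p^d≡1+q-1 : p ℕ.^ d ≡ suc (ℕ.pred (p ℕ.^ d))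
  p^d≡1+q-1 = sym (ℕ.suc-pred (p ℕ.^ d) {{ℕ.m^n≢0 p d}})

  size′ : HasSize F (suc (ℕ.pred (p ℕ.^ d)))
  size′ = subst (HasSize F) p^d≡1+q-1 size

  open FiniteField F size′ public

  ι[p]≡0 : ι p ≡ 0#
  ι[p]≡0 with ι p ≟ 0#
  ... | yes ιp≡0 = ιp≡0
  ... | no  ιp≢0 = ⊥-elim (^≢0 d ιp≢0 (trans (sym (ι-homo-^ p d)) (trans (cong ι p^d≡1+q-1) ι[q]≡0)))

  ι≢0 : ∀ {k} → 0 ℕ.< k → k ℕ.< p → ι k ≢ 0#
  ι≢0 {k} 0<k k<p ιk≡0 = 1≢0 (trans (sym (+-identityʳ 1#)) ι[1]≡0)
    where ι[1]≡0 = ι-gcd≡0 (coprime-Bézout (prime⇒coprime p-prime {{ℕ.>-nonZero 0<k}} k<p)) ι[p]≡0 ιk≡0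

  ι<-injective : ∀ {a b} → a ℕ.< b → b ℕ.< p → ι a ≢ ι b
  ι<-injective {a} {b} a<b b<p ιa≡ιb = ι≢0 (ℕ.m<n⇒0<n∸m a<b) (ℕ.≤-<-trans (ℕ.m∸n≤m b a) b<p)
    (+-cancelˡ (ι a) _ _ (begin
      ι a + ι (b ∸ a)   ≡⟨ sym (ι-homo-+ a (b ∸ a)) ⟩
      ι (a ℕ.+ (b ∸ a)) ≡⟨ cong ι (ℕ.m+[n∸m]≡n (ℕ.<⇒≤ a<b)) ⟩
      ι b               ≡⟨ sym ιa≡ιb ⟩
      ι a               ≡⟨ sym (+-identityʳ (ι a)) ⟩
      ι a + 0#          ∎))
    where open ≡-Reasoning

  ι-injective : ∀ {a b} → a ℕ.< p → b ℕ.< p → ι a ≡ ι b → a ≡ b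
  ι-injective = injective-below ι ι<-injective

  ^p-homo-+ : ∀ a b → (a + b) ^ p ≡ a ^ p + b ^ p
  ^p-homo-+ = freshman's-dream p-prime ι[p]≡0

  frob : ℕ → Carrier → Carrier
  frob i a = a ^ (p ℕ.^ i)

  frob-suc : ∀ i a → frob (suc i) a ≡ frob i (a ^ p)
  frob-suc i a = sym (^-*-assoc a p (p ℕ.^ i))

  frob-zero : ∀ a → frob 0 a ≡ a
  frob-zero = *-identityʳ

  frob-homo-+ : ∀ i a b → frob i (a + b) ≡ frob i a + frob i b
  frob-homo-+ zero    a b = trans (frob-zero _) (sym (cong₂ _+_ (frob-zero a) (frob-zero b)))
  frob-homo-+ (suc i) a b = begin
    frob (suc i) (a + b)           ≡⟨ frob-suc i (a + b) ⟩
    frob i ((a + b) ^ p)           ≡⟨ cong (frob i) (^p-homo-+ a b) ⟩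
    frob i (a ^ p + b ^ p)         ≡⟨ frob-homo-+ i _ _ ⟩
    frob i (a ^ p) + frob i (b ^ p) ≡⟨ sym (cong₂ _+_ (frob-suc i a) (frob-suc i b)) ⟩
    frob (suc i) a + frob (suc i) b ∎
    where open ≡-Reasoning

  frob-homo-* : ∀ i a b → frob i (a * b) ≡ frob i a * frob i b
  frob-homo-* i a b = ^-distribʳ-* a b (p ℕ.^ i)

  frob-homo-^ : ∀ i a k → frob i (a ^ k) ≡ frob i a ^ k
  frob-homo-^ i a k = ^-comm a k (p ℕ.^ i)

  frob-0# : ∀ i → frob i 0# ≡ 0#
  frob-0# i = 0^n≡0 (p ℕ.^ i) {{ℕ.m^n≢0 p i}}

  frob-frob : ∀ i j a → frob i (frob j a) ≡ frob (j ℕ.+ i) a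
  frob-frob i j a = trans (^-*-assoc a (p ℕ.^ j) (p ℕ.^ i)) (cong (a ^_) (sym (ℕ.^-distribˡ-+-* p j i)))

  frob-d : ∀ a → frob d a ≡ a
  frob-d a with a ≟ 0#
  ... | yes refl = frob-0# d
  ... | no  a≢0  = trans (cong (a ^_) p^d≡1+q-1) (trans (cong (a *_) (fermat a a≢0)) (*-identityʳ a))

  frob-inverseˡ : ∀ {j} → j ℕ.≤ d → ∀ a → frob j (frob (d ∸ j) a) ≡ a
  frob-inverseˡ {j} j≤d a = trans (frob-frob j (d ∸ j) a) (trans (cong (λ e → frob e a) (ℕ.m∸n+n≡m j≤d)) (frob-d a))

  frob-inverseʳ : ∀ {j} → j ℕ.≤ d → ∀ a → frob (d ∸ j) (frob j a) ≡ a
  frob-inverseʳ {j} j≤d a = trans (frob-frob (d ∸ j) j a) (trans (cong (λ e → frob e a) (ℕ.m+[n∸m]≡n j≤d)) (frob-d a))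

  frob-isUnitalAdditive : ∀ i → IsUnitalAdditive (frob i)
  frob-isUnitalAdditive i = record { +-homo = frob-homo-+ i ; 1#-homo = 1^n≡1 (p ℕ.^ i) }

  -- There are p^(d+1) polynomials of degree ≤ d with digits below p as coefficients,
  -- but only p^d values at x: the difference of two that agree at x annihilates x.
  ∃-annihilator : ∀ x → ∃[ P ] (¬ IsZero P × length P ≡ suc d ×
                                All (λ c → ∃[ a ] ∃[ b ] (c ≡ ι a - ι b)) P × eval P x ≡ 0#)
  ∃-annihilator x =
    P , P≢0 , List.length-tabulate coefficient , All.tabulate⁺ (λ i → digit t i , digit t′ i , refl) ,
    trans (eval-tabulate-difference (ι ∘ digit t) (ι ∘ digit t′) x)
          (trans (cong (_- eval (List.tabulate (ι ∘ digit t′)) x) same-value) (-‿inverseʳ _))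
    where
    digit : Fin (p ℕ.^ suc d) → Fin (suc d) → ℕ
    digit t = Fin.toℕ ∘ Fin.finToFun {p} {suc d} t
    value : Fin (p ℕ.^ suc d) → Fin (suc (ℕ.pred (p ℕ.^ d)))
    value t = to (eval (List.tabulate (ι ∘ digit t)) x)
    p^d<p^[1+d] : suc (ℕ.pred (p ℕ.^ d)) ℕ.< p ℕ.^ suc d
    p^d<p^[1+d] = subst (ℕ._< p ℕ.^ suc d) p^d≡1+q-1
      (subst (p ℕ.^ d ℕ.<_) (ℕ.*-comm (p ℕ.^ d) p)
        (ℕ.m<m*n (p ℕ.^ d) p {{ℕ.m^n≢0 p d}} (ℕ.nonTrivial⇒n>1 p {{prime⇒nonTrivial p-prime}})))
    collision = Fin.pigeonhole p^d<p^[1+d] value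
    t  = proj₁ collision
    t′ = proj₁ (proj₂ collision)
    same-value : eval (List.tabulate (ι ∘ digit t)) x ≡ eval (List.tabulate (ι ∘ digit t′)) x
    same-value = to-injective (proj₂ (proj₂ (proj₂ collision)))
    coefficient : Fin (suc d) → Carrier
    coefficient i = ι (digit t i) - ι (digit t′ i)
    P = List.tabulate coefficient
    P≢0 : ¬ IsZero P
    P≢0 P≡0 = Fin.<-irrefl t≡t′ (proj₁ (proj₂ (proj₂ collision)))
      where
      same-digits : ∀ i → Fin.finToFun {p} {suc d} t i ≡ Fin.finToFun t′ i
      same-digits i = Fin.toℕ-injective (ι-injective (Fin.toℕ<n _) (Fin.toℕ<n _)
        (x∙y⁻¹≈ε⇒x≈y _ _ (All.tabulate⁻ {f = coefficient} P≡0 i)))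
      t≡t′ : t ≡ t′
      t≡t′ = trans (sym (Fin.funToFin-finToFin {suc d} {p} t))
                   (trans (funToFin-cong same-digits) (Fin.funToFin-finToFin {suc d} {p} t′))

module Order (F : Field) where
  open FieldProperties F
  open Paley F using (HasOrder)

  hasOrder⇒≢0 : ∀ {u n} → HasOrder u n → .{{ℕ.NonZero n}} → u ≢ 0#
  hasOrder⇒≢0 {u} {suc n} (uⁿ≡1 , _) u≡0 = 0≢1 (trans (sym (zeroˡ (u ^ n))) (trans (cong (_* u ^ n) (sym u≡0)) uⁿ≡1))

  ^≡^[mod] : ∀ {u n} → u ^ n ≡ 1# → .{{_ : ℕ.NonZero n}} → ∀ m → u ^ m ≡ u ^ (m % n)
  ^≡^[mod] {u} {n} uⁿ≡1 m = begin
    u ^ m                               ≡⟨ cong (u ^_) (m≡m%n+[m/n]*n m n) ⟩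
    u ^ (m % n ℕ.+ (m / n) ℕ.* n)       ≡⟨ ^-homo-+ u (m % n) _ ⟩
    u ^ (m % n) * u ^ ((m / n) ℕ.* n)   ≡⟨ cong (u ^ (m % n) *_) (^[k*m]≡1 (m / n) uⁿ≡1) ⟩
    u ^ (m % n) * 1#                    ≡⟨ *-identityʳ _ ⟩
    u ^ (m % n)                         ∎
    where open ≡-Reasoning

  hasOrder⇒∣ : ∀ {u n} → HasOrder u n → .{{_ : ℕ.NonZero n}} → ∀ {m} → u ^ m ≡ 1# → n ∣ m
  hasOrder⇒∣ {u} {n} (uⁿ≡1 , minimal) {m} uᵐ≡1 with m % n in m%n≡r
  ... | zero  = m%n≡0⇒n∣m m n m%n≡r
  ... | suc r = ⊥-elim (minimal (suc r) (ℕ.s≤s ℕ.z≤n) (subst (ℕ._< n) m%n≡r (m%n<n m n))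
                  (trans (cong (u ^_) (sym m%n≡r)) (trans (sym (^≡^[mod] uⁿ≡1 m)) uᵐ≡1)))

  ∣⇒^≡1 : ∀ {u n m} → u ^ n ≡ 1# → n ∣ m → u ^ m ≡ 1#
  ∣⇒^≡1 uⁿ≡1 (divides k refl) = ^[k*m]≡1 k uⁿ≡1

  hasOrder-∣ : ∀ {u n} → u ^ n ≡ 1# → (∀ {k} → .{{ℕ.NonZero k}} → u ^ k ≡ 1# → n ∣ k) → HasOrder u n
  hasOrder-∣ uⁿ≡1 n∣ = uⁿ≡1 , λ k 1≤k k<n uᵏ≡1 →
    ℕ.<⇒≱ k<n (∣⇒≤ {{ℕ.>-nonZero 1≤k}} (n∣ {{ℕ.>-nonZero 1≤k}} uᵏ≡1))

  ^-injective : ∀ {u n} → HasOrder u n → ∀ {a b} → a ℕ.< n → b ℕ.< n → u ^ a ≡ u ^ b → a ≡ b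
  ^-injective {u} {n} u-order@(_ , minimal) = injective-below (u ^_) ^<-injective
    where
    ^<-injective : ∀ {a b} → a ℕ.< b → b ℕ.< n → u ^ a ≢ u ^ b
    ^<-injective {a} {b} a<b b<n uᵃ≡uᵇ = minimal (b ∸ a) (ℕ.m<n⇒0<n∸m a<b) (ℕ.≤-<-trans (ℕ.m∸n≤m b a) b<n)
      (*-cancelˡ (^≢0 a (hasOrder⇒≢0 u-order {{ℕ.>-nonZero (ℕ.≤-<-trans ℕ.z≤n b<n)}})) (begin
        u ^ a * u ^ (b ∸ a)   ≡⟨ sym (^-homo-+ u a (b ∸ a)) ⟩
        u ^ (a ℕ.+ (b ∸ a))   ≡⟨ cong (u ^_) (ℕ.m+[n∸m]≡n (ℕ.<⇒≤ a<b)) ⟩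
        u ^ b                 ≡⟨ sym uᵃ≡uᵇ ⟩
        u ^ a                 ≡⟨ sym (*-identityʳ _) ⟩
        u ^ a * 1#            ∎))
      where open ≡-Reasoning

  ^suc-injective : ∀ {u n} → HasOrder u n → ∀ {a b} → a ℕ.< n → b ℕ.< n → u ^ suc a ≡ u ^ suc b → a ≡ b
  ^suc-injective u-order a<n b<n =
    ^-injective u-order a<n b<n ∘ *-cancelˡ (hasOrder⇒≢0 u-order {{ℕ.>-nonZero (ℕ.≤-<-trans ℕ.z≤n a<n)}})

  hasOrder-^ : ∀ {u n} → HasOrder u n → .{{_ : ℕ.NonZero n}} → ∀ {v} → Coprime v n → HasOrder (u ^ v) n
  hasOrder-^ {u} {n} u-order@(uⁿ≡1 , _) {v} coprime[v,n] = hasOrder-∣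
    (trans (^-comm u v n) (trans (cong (_^ v) uⁿ≡1) (1^n≡1 v)))
    (λ uᵛᵏ≡1 → coprime-divisor (Coprime.sym coprime[v,n]) (hasOrder⇒∣ u-order (trans (sym (^-*-assoc u v _)) uᵛᵏ≡1)))

  hasOrder-^⇒coprime : ∀ {u n} → HasOrder u n → .{{_ : ℕ.NonZero n}} → ∀ {v} → HasOrder (u ^ v) n → Coprime v n
  hasOrder-^⇒coprime {u} {n} u-order {v} uᵛ-order {i} (divides v′ v≡v′i , divides n′ n≡n′i) =
    sym (ℕ.*-cancelˡ-≡ 1 i n (trans (ℕ.*-identityʳ n) (trans n≡n′i (cong (ℕ._* i) n′≡n))))
    where
    uᵛⁿ′≡1 : (u ^ v) ^ n′ ≡ 1#
    uᵛⁿ′≡1 = begin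
      (u ^ v) ^ n′              ≡⟨ ^-*-assoc u v n′ ⟩
      u ^ (v ℕ.* n′)            ≡⟨ cong (λ w → u ^ (w ℕ.* n′)) v≡v′i ⟩
      u ^ (v′ ℕ.* i ℕ.* n′)     ≡⟨ cong (u ^_) (trans (ℕ.*-assoc v′ i n′) (cong (v′ ℕ.*_) (trans (ℕ.*-comm i n′) (sym n≡n′i)))) ⟩
      u ^ (v′ ℕ.* n)            ≡⟨ ^[k*m]≡1 v′ (proj₁ u-order) ⟩
      1#                        ∎
      where open ≡-Reasoning
    n′≡n : n′ ≡ n
    n′≡n = ∣-antisym (divides i (trans n≡n′i (ℕ.*-comm n′ i))) (hasOrder⇒∣ uᵛ-order uᵛⁿ′≡1)

  hasOrder-1 : HasOrder 1# 1
  hasOrder-1 = *-identityʳ 1# , λ { k (ℕ.s≤s _) (ℕ.s≤s ()) }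

  hasOrder-* : ∀ {g h a b} → HasOrder g a → HasOrder h b → .{{_ : ℕ.NonZero a}} → .{{_ : ℕ.NonZero b}} →
               Coprime a b → HasOrder (g * h) (a ℕ.* b)
  hasOrder-* {g} {h} {a} {b} g-order h-order coprime[a,b] = hasOrder-∣ [gh]ᵃᵇ≡1 λ {k} [gh]ᵏ≡1 →
    coprime-∣⇒*∣ coprime[a,b]
      (coprime-divisor coprime[a,b] (subst (a ∣_) (ℕ.*-comm k b) (order∣ g-order h b k (proj₁ h-order) [gh]ᵏ≡1)))
      (coprime-divisor (Coprime.sym coprime[a,b])
        (subst (b ∣_) (ℕ.*-comm k a) (order∣ h-order g a k (proj₁ g-order) (trans (cong (_^ k) (*-comm h g)) [gh]ᵏ≡1))))
    where
    [gh]ᵃᵇ≡1 : (g * h) ^ (a ℕ.* b) ≡ 1#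
    [gh]ᵃᵇ≡1 = begin
      (g * h) ^ (a ℕ.* b)           ≡⟨ ^-distribʳ-* g h (a ℕ.* b) ⟩
      g ^ (a ℕ.* b) * h ^ (a ℕ.* b) ≡⟨ cong₂ _*_ (∣⇒^≡1 (proj₁ g-order) (m∣m*n {a} b)) (∣⇒^≡1 (proj₁ h-order) (n∣m*n a)) ⟩
      1# * 1#                       ≡⟨ *-identityˡ 1# ⟩
      1#                            ∎
      where open ≡-Reasoning
    order∣ : ∀ {u m} → HasOrder u m → .{{ℕ.NonZero m}} → ∀ v n k → v ^ n ≡ 1# → (u * v) ^ k ≡ 1# → m ∣ k ℕ.* n
    order∣ {u} u-order v n k vⁿ≡1 [uv]ᵏ≡1 = hasOrder⇒∣ u-order (begin
      u ^ (k ℕ.* n)                   ≡⟨ sym (*-identityʳ _) ⟩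
      u ^ (k ℕ.* n) * 1#              ≡⟨ cong (u ^ (k ℕ.* n) *_) (sym (^[k*m]≡1 k vⁿ≡1)) ⟩
      u ^ (k ℕ.* n) * v ^ (k ℕ.* n)   ≡⟨ sym (^-distribʳ-* u v (k ℕ.* n)) ⟩
      (u * v) ^ (k ℕ.* n)             ≡⟨ sym (^-*-assoc (u * v) k n) ⟩
      ((u * v) ^ k) ^ n               ≡⟨ cong (_^ n) [uv]ᵏ≡1 ⟩
      1# ^ n                          ≡⟨ 1^n≡1 n ⟩
      1#                              ∎)
      where open ≡-Reasoning

module MultiplicativeGroup (F : Field) {q-1 : ℕ} (size : HasSize F (suc q-1)) where
  open FieldProperties F
  open FiniteField F size
  open Polynomial F using (#roots-of-^≤)
  open Order F
  open Paley F using (HasOrder)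

  -- The n distinct powers of x₀ are roots of Xⁿ - 1, which has no further roots.
  roots-of-unity : ∀ {x₀ n} → HasOrder x₀ n → .{{_ : ℕ.NonZero n}} → ∀ {x} → x ^ n ≡ 1# →
                   ∃[ k ] (k ℕ.< n × x ≡ x₀ ^ k)
  roots-of-unity {x₀} {n} x₀-order {x} xⁿ≡1 with ℕ.anyUpTo? (λ k → x ≟ x₀ ^ k) n
  ... | yes found = found
  ... | no  none  = ⊥-elim (ℕ.<-irrefl refl
    (#roots-of-^≤ n 1# (x Vector.∷ λ i → x₀ ^ Fin.toℕ i) (∷-injective x (x₀ ^_) (^-injective x₀-order) none) roots))
    where
    roots : ∀ i → (x Vector.∷ λ i → x₀ ^ Fin.toℕ i) i ^ n ≡ 1#
    roots Fin.zero    = xⁿ≡1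
    roots (Fin.suc i) = trans (^-comm x₀ (Fin.toℕ i) n) (trans (cong (_^ Fin.toℕ i) (proj₁ x₀-order)) (1^n≡1 (Fin.toℕ i)))

  roots-of-unity₁ : ∀ {x₀ n} → HasOrder x₀ n → .{{_ : ℕ.NonZero n}} → ∀ {x} → x ^ n ≡ 1# →
                    ∃[ k ] (k ℕ.< n × x ≡ x₀ ^ suc k)
  roots-of-unity₁ {x₀} {suc n} x₀-order xⁿ≡1 with roots-of-unity x₀-order xⁿ≡1
  ... | suc k , 1+k<1+n , x≡x₀^[1+k] = k , ℕ.<-trans (ℕ.n<1+n k) 1+k<1+n , x≡x₀^[1+k]
  ... | zero  , _       , x≡1        = n , ℕ.n<1+n n , trans x≡1 (sym (proj₁ x₀-order))

  -- With q - 1 = t ℓ^(e+1), some z has z^(t ℓ^e) ≠ 1, since X^(t ℓ^e) - 1 has fewer than q - 1 roots;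
  -- then z^t has order ℓ^(e+1).
  ∃-hasOrder-prime-power : ∀ {ℓ} → Prime ℓ → ∀ e → ℓ ℕ.^ suc e ∣ q-1 → ∃[ g ] HasOrder g (ℓ ℕ.^ suc e)
  ∃-hasOrder-prime-power {ℓ} ℓ-prime e (divides t q-1≡t*ℓ^[1+e])
    with Fin.any? (λ i → ¬? (nonzero i ^ (t ℕ.* ℓ ℕ.^ e) ≟ 1#))
  ... | no all-roots = ⊥-elim (ℕ.<⇒≱ M<q-1 (#roots-of-^≤ M {{M≢0}} 1# nonzero nonzero-injective roots))
    where
    instance _ = prime⇒nonZero ℓ-prime
    M = t ℕ.* ℓ ℕ.^ e
    q-1≡M*ℓ : q-1 ≡ M ℕ.* ℓ
    q-1≡M*ℓ = trans q-1≡t*ℓ^[1+e] (trans (cong (t ℕ.*_) (ℕ.*-comm ℓ (ℓ ℕ.^ e))) (sym (ℕ.*-assoc t _ ℓ)))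
    M≢0 : ℕ.NonZero M
    M≢0 = ℕ.m*n≢0⇒m≢0 M {{subst ℕ.NonZero q-1≡M*ℓ (ℕ.>-nonZero 1≤q-1)}}
    M<q-1 : M ℕ.< q-1
    M<q-1 = subst (M ℕ.<_) (sym q-1≡M*ℓ) (ℕ.m<m*n M ℓ {{M≢0}} (ℕ.nonTrivial⇒n>1 ℓ {{prime⇒nonTrivial ℓ-prime}}))
    roots : ∀ i → nonzero i ^ M ≡ 1#
    roots i with nonzero i ^ M ≟ 1#
    ... | yes root = root
    ... | no  non-root = ⊥-elim (all-roots (i , non-root))
  ... | yes (i , zᴹ≢1) = z ^ t , gᴸ≡1 , minimal
    where
    z = nonzero i
    L = ℓ ℕ.^ suc e
    gᴸ≡1 : (z ^ t) ^ L ≡ 1#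
    gᴸ≡1 = trans (^-*-assoc z t L) (trans (cong (z ^_) (sym q-1≡t*ℓ^[1+e])) (fermat z (nonzero≢0 i)))
    minimal : ∀ k → 1 ℕ.≤ k → k ℕ.< L → (z ^ t) ^ k ≢ 1#
    minimal k 1≤k k<L gᵏ≡1 = zᴹ≢1 (trans (sym (^-*-assoc z t (ℓ ℕ.^ e))) (∣⇒^≡1 gᵍᶜᵈ≡1 gcd∣ℓ^e))
      where
      gᵍᶜᵈ≡1 : (z ^ t) ^ gcd k L ≡ 1#
      gᵍᶜᵈ≡1 = ^-gcd≡1 (z ^ t) (Bézout.identity (gcd-GCD k L)) gᵏ≡1 gᴸ≡1
      gcd∣ℓ^e : gcd k L ∣ ℓ ℕ.^ e
      gcd∣ℓ^e = proper-divisor-of-prime-power ℓ-prime e (gcd[m,n]∣n k L)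
        (ℕ.≤-<-trans (∣⇒≤ {{ℕ.>-nonZero 1≤k}} (gcd[m,n]∣m k L)) k<L)

  ∃-hasOrder : ∀ n → .{{ℕ.NonZero n}} → n ∣ q-1 → ∃[ g ] HasOrder g n
  ∃-hasOrder = <-rec _ build
    where
    build : ∀ n → (∀ {m} → m ℕ.< n → .{{ℕ.NonZero m}} → m ∣ q-1 → ∃[ g ] HasOrder g m) →
            .{{ℕ.NonZero n}} → n ∣ q-1 → ∃[ g ] HasOrder g n
    build 1 _ _ = 1# , hasOrder-1
    build n@(suc (suc _)) rec n∣q-1 with ∃-prime-divisor n (ℕ.s≤s (ℕ.s≤s ℕ.z≤n))
    ... | ℓ , ℓ-prime , ℓ∣n with prime-power-split ℓ-prime n
    ...   | zero  , m , n≡1*m , ℓ∤m = ⊥-elim (ℓ∤m (subst (ℓ ∣_) (trans n≡1*m (ℕ.*-identityˡ m)) ℓ∣n))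
    ...   | suc e , m , n≡ℓ^[1+e]*m , ℓ∤m =
      proj₁ g-exists * proj₁ h-exists ,
      subst (HasOrder _) (sym n≡ℓ^[1+e]*m)
        (hasOrder-* (proj₂ g-exists) (proj₂ h-exists) (coprime-^ˡ (prime∤⇒coprime ℓ-prime ℓ∤m) (suc e)))
      where
      instance
        m≢0 : ℕ.NonZero m
        m≢0 = ℕ.m*n≢0⇒n≢0 (ℓ ℕ.^ suc e) {{subst ℕ.NonZero n≡ℓ^[1+e]*m _}}
        ℓ^[1+e]≢0 : ℕ.NonZero (ℓ ℕ.^ suc e)
        ℓ^[1+e]≢0 = ℕ.m^n≢0 ℓ (suc e) {{prime⇒nonZero ℓ-prime}}
      m<n : m ℕ.< n
      m<n = subst (m ℕ.<_) (trans (ℕ.*-comm m _) (sym n≡ℓ^[1+e]*m)) (ℕ.m<m*n m (ℓ ℕ.^ suc e)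
        (ℕ.<-≤-trans (ℕ.nonTrivial⇒n>1 ℓ {{prime⇒nonTrivial ℓ-prime}}) (ℕ.m≤m*n ℓ (ℓ ℕ.^ e) {{ℕ.m^n≢0 ℓ e {{prime⇒nonZero ℓ-prime}}}})))
      g-exists = ∃-hasOrder-prime-power ℓ-prime e (∣-trans (divides m (trans n≡ℓ^[1+e]*m (ℕ.*-comm _ m))) n∣q-1)
      h-exists = rec m<n (∣-trans (divides (ℓ ℕ.^ suc e) n≡ℓ^[1+e]*m) n∣q-1)

module FrobeniusOrbits (F : Field) {n p d : ℕ} .{{_ : ℕ.NonZero n}} (p-prime : Prime p) (p⊥n : Coprime p n)
                       (d-order : IsMultOrder n p d) (size : HasSize F (p ℕ.^ d)) where
  open FieldProperties F
  open Frobenius F {d = d} p-prime size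
  open Order F
  open MultiplicativeGroup F size′
  open Polynomial F using (eval; root-bound; eval-homo)
  open Paley F using (HasOrder)

  instance
    d≢0 : ℕ.NonZero d
    d≢0 = ℕ.>-nonZero (proj₁ d-order)

  IsGenerator : Carrier → Set
  IsGenerator u = HasOrder u n

  isGenerator? : ∀ u → Dec (IsGenerator u)
  isGenerator? u = (u ^ n ≟ 1#) ×-dec Dec.map′ (λ h k 1≤k k<n → h k<n 1≤k) (λ h {k} k<n 1≤k → h k 1≤k k<n)
    (ℕ.allUpTo? (λ k → (1 ℕ.≤? k) →-dec ¬? (u ^ k ≟ 1#)) n)

  x₀-exists : ∃[ x₀ ] IsGenerator x₀
  x₀-exists = ∃-hasOrder n (subst (n ∣_) (sym (ℕ.pred[m∸n]≡m∸[1+n] (p ℕ.^ d) 0)) (proj₁ (proj₂ d-order)))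

  frob-generator : ∀ {u} j → IsGenerator u → IsGenerator (frob j u)
  frob-generator j u-generator = hasOrder-^ u-generator (coprime-^ˡ p⊥n j)

  frob-*d : ∀ m u → frob (m ℕ.* d) u ≡ u
  frob-*d zero    u = frob-zero u
  frob-*d (suc m) u = begin
    frob (d ℕ.+ m ℕ.* d) u       ≡⟨ sym (frob-frob (m ℕ.* d) d u) ⟩
    frob (m ℕ.* d) (frob d u)    ≡⟨ cong (frob (m ℕ.* d)) (frob-d u) ⟩
    frob (m ℕ.* d) u             ≡⟨ frob-*d m u ⟩
    u                            ∎
    where open ≡-Reasoning

  frob-mod : ∀ k u → frob k u ≡ frob (k % d) u
  frob-mod k u = begin
    frob k u                                 ≡⟨ cong (λ e → frob e u) (trans (m≡m%n+[m/n]*n k d) (ℕ.+-comm (k % d) _)) ⟩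
    frob ((k / d) ℕ.* d ℕ.+ k % d) u         ≡⟨ sym (frob-frob (k % d) ((k / d) ℕ.* d) u) ⟩
    frob (k % d) (frob ((k / d) ℕ.* d) u)    ≡⟨ cong (frob (k % d)) (frob-*d (k / d) u) ⟩
    frob (k % d) u                           ∎
    where open ≡-Reasoning

  -- w^(p^k) = w makes n divide p^k - 1, contradicting the minimality of d.
  frob-no-small-fixed-point : ∀ {w} → IsGenerator w → ∀ k → 1 ℕ.≤ k → k ℕ.< d → frob k w ≢ w
  frob-no-small-fixed-point {w} w-generator k 1≤k k<d frob[w]≡w =
    proj₂ (proj₂ d-order) k 1≤k k<d (hasOrder⇒∣ w-generator w^[p^k∸1]≡1)
    where
    w^[p^k∸1]≡1 : w ^ (p ℕ.^ k ∸ 1) ≡ 1#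
    w^[p^k∸1]≡1 = *-cancelˡ (hasOrder⇒≢0 w-generator) (begin
      w * w ^ (p ℕ.^ k ∸ 1)   ≡⟨ cong (w ^_) (ℕ.m+[n∸m]≡n {1} (ℕ.m^n>0 p {{prime⇒nonZero p-prime}} k)) ⟩
      frob k w                ≡⟨ frob[w]≡w ⟩
      w                       ≡⟨ sym (*-identityʳ w) ⟩
      w * 1#                  ∎)
      where open ≡-Reasoning

  frob-orbit-injective : ∀ {u} → IsGenerator u → ∀ {i j} → i ℕ.< d → j ℕ.< d → frob i u ≡ frob j u → i ≡ j
  frob-orbit-injective {u} u-generator = injective-below (λ i → frob i u) strict
    where
    strict : ∀ {i j} → i ℕ.< j → j ℕ.< d → frob i u ≢ frob j u
    strict {i} {j} i<j j<d frobᵢu≡frobⱼu = frob-no-small-fixed-point (frob-generator i u-generator) (j ∸ i)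
      (ℕ.m<n⇒0<n∸m i<j) (ℕ.≤-<-trans (ℕ.m∸n≤m j i) j<d)
      (trans (frob-frob (j ∸ i) i u) (trans (cong (λ e → frob e u) (ℕ.m+[n∸m]≡n (ℕ.<⇒≤ i<j))) (sym frobᵢu≡frobⱼu)))

  -- Each orbit is represented by its element with the least rank under the enumeration of F.
  rank : Carrier → ℕ
  rank = Fin.toℕ ∘ to

  IsCanonical : Carrier → Set
  IsCanonical c = IsGenerator c × (∀ {j} → j ℕ.< d → rank c ℕ.≤ rank (frob j c))

  isCanonical? : ∀ c → Dec (IsCanonical c)
  isCanonical? c = isGenerator? c ×-dec ℕ.allUpTo? (λ j → rank c ℕ.≤? rank (frob j c)) d

  canonical-unique : ∀ {c₁ c₂} → IsCanonical c₁ → IsCanonical c₂ →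
                     ∀ {i} → i ℕ.< d → c₂ ≡ frob i c₁ → c₁ ≡ c₂
  canonical-unique {c₁} {c₂} (_ , c₁-least) (_ , c₂-least) {i} i<d c₂≡frobᵢc₁ =
    to-injective (Fin.toℕ-injective (ℕ.≤-antisym
      (subst (λ c → rank c₁ ℕ.≤ rank c) (sym c₂≡frobᵢc₁) (c₁-least i<d))
      (subst (λ c → rank c₂ ℕ.≤ rank c) back (c₂-least (m%n<n (d ∸ i) d)))))
    where
    back : frob ((d ∸ i) % d) c₂ ≡ c₁
    back = trans (sym (frob-mod (d ∸ i) c₂))
                 (trans (cong (frob (d ∸ i)) c₂≡frobᵢc₁) (frob-inverseʳ (ℕ.<⇒≤ i<d) c₁))

  canonical-exists : ∀ {u} → IsGenerator u → Σ[ c ∈ Carrier ] Σ[ j ∈ Fin d ] (IsCanonical c × frob (Fin.toℕ j) c ≡ u)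
  canonical-exists {u} u-generator = frob j₀ u , Fin.fromℕ< (m%n<n (d ∸ j₀) d) , (frob-generator j₀ u-generator , least) , back
    where
    f : ℕ → ℕ
    f j = rank (frob j u)
    j₀ = argmin f 0 (upTo d)
    j₀<d : j₀ ℕ.< d
    j₀<d with argmin-sel f 0 (upTo d)
    ... | inj₁ j₀≡0 = subst (ℕ._< d) (sym j₀≡0) (ℕ.>-nonZero⁻¹ d)
    ... | inj₂ j₀∈  = ∈-upTo⁻ j₀∈
    least : ∀ {i} → i ℕ.< d → rank (frob j₀ u) ℕ.≤ rank (frob i (frob j₀ u))
    least {i} i<d = subst (λ c → f j₀ ℕ.≤ rank c) (sym (trans (frob-frob i j₀ u) (frob-mod (j₀ ℕ.+ i) u)))
      (All.lookup (f[argmin]≤f[xs] {f = f} 0 (upTo d)) (∈-upTo⁺ (m%n<n (j₀ ℕ.+ i) d)))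
    back : frob (Fin.toℕ (Fin.fromℕ< (m%n<n (d ∸ j₀) d))) (frob j₀ u) ≡ u
    back = trans (cong (λ e → frob e (frob j₀ u)) (Fin.toℕ-fromℕ< (m%n<n (d ∸ j₀) d)))
      (trans (sym (frob-mod (d ∸ j₀) (frob j₀ u))) (frob-inverseʳ (ℕ.<⇒≤ j₀<d) u))

  canonical-decomposition-unique : ∀ {c c′} → IsCanonical c → IsCanonical c′ → ∀ (j j′ : Fin d) →
                                   frob (Fin.toℕ j) c ≡ frob (Fin.toℕ j′) c′ → c ≡ c′ × j ≡ j′
  canonical-decomposition-unique {c} {c′} c-canonical c′-canonical j j′ frobⱼc≡frobⱼ′c′ =
    c≡c′ , Fin.toℕ-injective (frob-orbit-injective (proj₁ c-canonical) (Fin.toℕ<n j) (Fin.toℕ<n j′)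
             (trans frobⱼc≡frobⱼ′c′ (cong (frob (Fin.toℕ j′)) (sym c≡c′))))
    where
    c′≡ : c′ ≡ frob ((Fin.toℕ j ℕ.+ (d ∸ Fin.toℕ j′)) % d) c
    c′≡ = begin
      c′                                                  ≡⟨ sym (frob-inverseʳ (ℕ.<⇒≤ (Fin.toℕ<n j′)) c′) ⟩
      frob (d ∸ Fin.toℕ j′) (frob (Fin.toℕ j′) c′)        ≡⟨ cong (frob (d ∸ Fin.toℕ j′)) (sym frobⱼc≡frobⱼ′c′) ⟩
      frob (d ∸ Fin.toℕ j′) (frob (Fin.toℕ j) c)          ≡⟨ frob-frob (d ∸ Fin.toℕ j′) (Fin.toℕ j) c ⟩
      frob (Fin.toℕ j ℕ.+ (d ∸ Fin.toℕ j′)) c             ≡⟨ frob-mod _ c ⟩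
      frob ((Fin.toℕ j ℕ.+ (d ∸ Fin.toℕ j′)) % d) c       ∎
      where open ≡-Reasoning
    c≡c′ : c ≡ c′
    c≡c′ = canonical-unique c-canonical c′-canonical (m%n<n _ d) c′≡

  -- Every polynomial over the prime field vanishing at x₁ vanishes at x₂ and at the d distinct
  -- conjugates of x₁; an annihilator of degree ≤ d leaves no room for x₂ outside the orbit.
  intertwiner⇒conjugate : ∀ {x₁ x₂} → IsGenerator x₁ → ∀ {σ} → IsUnitalAdditive σ →
                          (∀ a → σ (x₁ * a) ≡ x₂ * σ a) → ∃[ i ] (i ℕ.< d × x₂ ≡ frob i x₁)
  intertwiner⇒conjugate {x₁} {x₂} x₁-generator σ-homo σ-x with ℕ.anyUpTo? (λ i → x₂ ≟ frob i x₁) d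
  ... | yes conjugate     = conjugate
  ... | no  not-conjugate = ⊥-elim (ℕ.<-irrefl (sym length-P)
          (root-bound (suc d) P P≢0 ρ
            (∷-injective x₂ (λ i → frob i x₁) (frob-orbit-injective x₁-generator) not-conjugate) roots))
    where
    annihilator = ∃-annihilator x₁
    P = proj₁ annihilator
    P≢0 = proj₁ (proj₂ annihilator)
    length-P = proj₁ (proj₂ (proj₂ annihilator))
    ρ : Fin (suc d) → Carrier
    ρ = x₂ Vector.∷ λ i → frob (Fin.toℕ i) x₁
    root : ∀ {τ y} → IsUnitalAdditive τ → (∀ a → τ (x₁ * a) ≡ y * τ a) → eval P y ≡ 0#
    root {τ} τ-homo τ-x = begin
      eval P _        ≡⟨ sym (eval-homo τ-homo τ-x P (All.map fixed (proj₁ (proj₂ (proj₂ (proj₂ annihilator)))))) ⟩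
      τ (eval P x₁)   ≡⟨ cong τ (proj₂ (proj₂ (proj₂ (proj₂ annihilator)))) ⟩
      τ 0#            ≡⟨ IsUnitalAdditive.0#-homo τ-homo ⟩
      0#              ∎
      where
      open ≡-Reasoning
      fixed : ∀ {c} → ∃[ a ] ∃[ b ] (c ≡ ι a - ι b) → τ c ≡ c
      fixed (a , b , refl) = IsUnitalAdditive.ι-difference-fixed τ-homo a b
    roots : ∀ i → eval P (ρ i) ≡ 0#
    roots Fin.zero    = root σ-homo σ-x
    roots (Fin.suc i) = root (frob-isUnitalAdditive (Fin.toℕ i)) (frob-homo-* (Fin.toℕ i) x₁)

  isGenerator : Carrier → Bool
  isGenerator u = isYes (isGenerator? u)

  generator : ∀ {u} → IsGenerator u → T (isGenerator u)
  generator = fromWitness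

  generator⁻¹ : ∀ {u} → T (isGenerator u) → IsGenerator u
  generator⁻¹ = toWitness

  isCanonical : Carrier → Bool
  isCanonical c = isYes (isCanonical? c)

  canonical : ∀ {c} → IsCanonical c → T (isCanonical c)
  canonical = fromWitness

  canonical⁻¹ : ∀ {c} → T (isCanonical c) → IsCanonical c
  canonical⁻¹ = toWitness

  isUnit : Fin n → Bool
  isUnit k = isYes (gcd (suc (Fin.toℕ k)) n ℕ.≟ 1)

  unit : ∀ {k} → Coprime (suc (Fin.toℕ k)) n → T (isUnit k)
  unit = fromWitness ∘ coprime⇒gcd≡1

  unit⁻¹ : ∀ {k} → T (isUnit k) → Coprime (suc (Fin.toℕ k)) n
  unit⁻¹ = gcd≡1⇒coprime ∘ toWitness

  units↔generators : (Σ[ k ∈ Fin n ] T (isUnit k)) ↔ (Σ[ u ∈ Carrier ] T (isGenerator u))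
  units↔generators = mk↔ₛ′ power logarithm power∘logarithm logarithm∘power
    where
    x₀ = proj₁ x₀-exists
    x₀-generator = proj₂ x₀-exists
    power : Σ[ k ∈ Fin n ] T (isUnit k) → Σ[ u ∈ Carrier ] T (isGenerator u)
    power (k , k-unit) = x₀ ^ suc (Fin.toℕ k) , generator (hasOrder-^ x₀-generator (unit⁻¹ k-unit))
    exponent : ∀ {u} → IsGenerator u → Σ[ k ∈ Fin n ] (x₀ ^ suc (Fin.toℕ k) ≡ u)
    exponent u-generator with roots-of-unity₁ x₀-generator (proj₁ u-generator)
    ... | k , k<n , u≡x₀^[1+k] = Fin.fromℕ< k<n , trans (cong (λ i → x₀ ^ suc i) (Fin.toℕ-fromℕ< k<n)) (sym u≡x₀^[1+k])
    exponent-unique : ∀ {u} (u-generator : IsGenerator u) k → x₀ ^ suc (Fin.toℕ k) ≡ u → proj₁ (exponent u-generator) ≡ k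
    exponent-unique u-generator k x₀^[1+k]≡u = Fin.toℕ-injective (^suc-injective x₀-generator (Fin.toℕ<n _) (Fin.toℕ<n k)
      (trans (proj₂ (exponent u-generator)) (sym x₀^[1+k]≡u)))
    logarithm : Σ[ u ∈ Carrier ] T (isGenerator u) → Σ[ k ∈ Fin n ] T (isUnit k)
    logarithm (u , u-generator) = proj₁ (exponent (generator⁻¹ u-generator)) ,
      unit (hasOrder-^⇒coprime x₀-generator
        (subst IsGenerator (sym (proj₂ (exponent (generator⁻¹ u-generator)))) (generator⁻¹ u-generator)))
    power∘logarithm : ∀ v → power (logarithm v) ≡ v
    power∘logarithm (u , u-generator) = Σ-T-≡ (proj₂ (exponent (generator⁻¹ u-generator)))
    logarithm∘power : ∀ k → logarithm (power k) ≡ k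
    logarithm∘power (k , k-unit) = Σ-T-≡ (exponent-unique (generator⁻¹ (proj₂ (power (k , k-unit)))) k refl)

  orbits↔generators : ((Σ[ c ∈ Carrier ] T (isCanonical c)) × Fin d) ↔ (Σ[ u ∈ Carrier ] T (isGenerator u))
  orbits↔generators = mk↔ₛ′ apply decompose apply∘decompose decompose∘apply
    where
    apply : (Σ[ c ∈ Carrier ] T (isCanonical c)) × Fin d → Σ[ u ∈ Carrier ] T (isGenerator u)
    apply ((c , c-canonical) , j) = frob (Fin.toℕ j) c , generator (frob-generator (Fin.toℕ j) (proj₁ (canonical⁻¹ c-canonical)))
    decompose : Σ[ u ∈ Carrier ] T (isGenerator u) → (Σ[ c ∈ Carrier ] T (isCanonical c)) × Fin d
    decompose (u , u-generator) =
      (proj₁ decomposition , canonical (proj₁ (proj₂ (proj₂ decomposition)))) , proj₁ (proj₂ decomposition)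
      where decomposition = canonical-exists (generator⁻¹ u-generator)
    apply∘decompose : ∀ v → apply (decompose v) ≡ v
    apply∘decompose (u , u-generator) = Σ-T-≡ (proj₂ (proj₂ (proj₂ (canonical-exists (generator⁻¹ u-generator)))))
    decompose∘apply : ∀ w → decompose (apply w) ≡ w
    decompose∘apply ((c , c-canonical) , j) = cong₂ _,_ (Σ-T-≡ (proj₁ same)) (proj₂ same)
      where
      decomposition = canonical-exists (generator⁻¹ (proj₂ (apply ((c , c-canonical) , j))))
      same = canonical-decomposition-unique (proj₁ (proj₂ (proj₂ decomposition))) (canonical⁻¹ c-canonical)
               (proj₁ (proj₂ decomposition)) j (proj₂ (proj₂ (proj₂ decomposition)))

  #orbits : ℕ
  #orbits = count (isCanonical ∘ from)

  φ≡#orbits*d : φ n ≡ #orbits ℕ.* d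
  φ≡#orbits*d = begin
    φ n                               ≡⟨ length-filter-applyUpTo (λ k → gcd (suc k) n ℕ.≟ 1) n id ⟩
    count isUnit                      ≡⟨ ↔⇒≡ (↔-trans (enumerate isUnit) (↔-trans units↔generators (↔-sym (enumerate-Carrier isGenerator)))) ⟩
    count (isGenerator ∘ from)        ≡⟨ sym (↔⇒≡ (↔-trans *↔× (↔-trans (enumerate-Carrier isCanonical ×-↔ ↔-refl)
                                           (↔-trans orbits↔generators (↔-sym (enumerate-Carrier isGenerator)))))) ⟩
    #orbits ℕ.* d                     ∎
    where open ≡-Reasoning

module IsomorphismInvariants (F : Field) {n : ℕ} .{{_ : ℕ.NonZero n}} {x₁ x₂ : Field.Carrier F}
  (x₂-order : Paley.HasOrder F x₂ n) (f : Paley.Aff F → Paley.Aff F)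
  (f-G : ∀ g → Paley.InG F x₁ g → Paley.InG F x₂ (f g))
  (f-homo : ∀ g h → Paley.InG F x₁ g → Paley.InG F x₁ h → f (Paley._∘ᵃ_ F g h) ≡ Paley._∘ᵃ_ F (f g) (f h))
  (f-x : f (Paley.mult F x₁) ≡ Paley.mult F x₂) where
  open FieldProperties F
  open Paley F
  open Order F

  identity : Aff
  identity = mult 1#

  translation : Carrier → Aff
  translation u = 1# , u

  translation-G : ∀ u → InG x₁ (translation u)
  translation-G u = 0 , refl

  S-≢0 : ∀ {a} → InS x₂ a → a ≢ 0#
  S-≢0 (k , a≡x₂ᵏ) a≡0 = ^≢0 k (hasOrder⇒≢0 x₂-order) (trans (sym a≡x₂ᵏ) a≡0)

  S-^n≡1 : ∀ {a} → InS x₂ a → a ^ n ≡ 1#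
  S-^n≡1 (k , a≡x₂ᵏ) =
    trans (cong (_^ n) a≡x₂ᵏ) (trans (^-comm x₂ k n) (trans (cong (_^ k) (proj₁ x₂-order)) (1^n≡1 k)))

  mult-∘ : ∀ a b → mult a ∘ᵃ mult b ≡ mult (a * b)
  mult-∘ a b = cong (a * b ,_) (trans (cong (_+ 0#) (zeroʳ a)) (+-identityʳ 0#))

  mult-x₁-G : InG x₁ (mult x₁)
  mult-x₁-G = 1 , sym (*-identityʳ x₁)

  f-identity : f identity ≡ identity
  f-identity = cong₂ _,_ a≡1 b≡0
    where
    a = proj₁ (f identity)
    b = proj₂ (f identity)
    idempotent : f identity ≡ f identity ∘ᵃ f identity
    idempotent = trans (cong f (trans (cong mult (sym (*-identityˡ 1#))) (sym (mult-∘ 1# 1#))))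
                       (f-homo identity identity (translation-G 0#) (translation-G 0#))
    a≡1 : a ≡ 1#
    a≡1 = *-cancelˡ (S-≢0 (f-G identity (translation-G 0#))) (trans (sym (cong proj₁ idempotent)) (sym (*-identityʳ a)))
    b≡0 : b ≡ 0#
    b≡0 = +-cancelʳ b b 0# (begin
      b + b        ≡⟨ cong (_+ b) (trans (sym (*-identityˡ b)) (cong (_* b) (sym a≡1))) ⟩
      a * b + b    ≡⟨ sym (cong proj₂ idempotent) ⟩
      b            ≡⟨ sym (+-identityˡ b) ⟩
      0# + b       ∎)
      where open ≡-Reasoning

  translation-∘ : ∀ a b → translation a ∘ᵃ translation b ≡ translation (b + a)
  translation-∘ a b = cong₂ _,_ (*-identityˡ 1#) (cong (_+ a) (*-identityˡ b))

  f-mult-^ : ∀ c → f (mult (x₁ ^ c)) ≡ mult (x₂ ^ c)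
  f-mult-^ zero    = f-identity
  f-mult-^ (suc c) = begin
    f (mult (x₁ * x₁ ^ c))                 ≡⟨ cong f (sym (mult-∘ x₁ (x₁ ^ c))) ⟩
    f (mult x₁ ∘ᵃ mult (x₁ ^ c))           ≡⟨ f-homo _ _ mult-x₁-G (c , refl) ⟩
    f (mult x₁) ∘ᵃ f (mult (x₁ ^ c))       ≡⟨ cong₂ _∘ᵃ_ f-x (f-mult-^ c) ⟩
    mult x₂ ∘ᵃ mult (x₂ ^ c)               ≡⟨ mult-∘ x₂ (x₂ ^ c) ⟩
    mult (x₂ * x₂ ^ c)                     ∎
    where open ≡-Reasoning

  module _ {p : ℕ} (ι[p]≡0 : ι p ≡ 0#) (p⊥n : Coprime p n) where

    α : Carrier → Carrier
    α u = proj₂ (f (translation u))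

    -- The linear part of f (translation u) is both a p-th and an n-th root of unity.
    f-translation : ∀ u → f (translation u) ≡ translation (α u)
    f-translation u = cong (_, α u) (trans (sym (*-identityʳ _)) linear[u]¹≡1)
      where
      linear : Carrier → Carrier
      linear v = proj₁ (f (translation v))
      linear-+ : ∀ a b → linear (b + a) ≡ linear a * linear b
      linear-+ a b = trans (cong (proj₁ ∘ f) (sym (translation-∘ a b))) (cong proj₁ (f-homo _ _ (translation-G a) (translation-G b)))
      linear-ι* : ∀ k → linear (ι k * u) ≡ linear u ^ k
      linear-ι* zero    = trans (cong linear (zeroˡ u)) (cong proj₁ f-identity)
      linear-ι* (suc k) = begin
        linear ((1# + ι k) * u)       ≡⟨ cong linear (trans (distribʳ u 1# (ι k)) (trans (cong (_+ ι k * u) (*-identityˡ u)) (+-comm u _))) ⟩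
        linear (ι k * u + u)          ≡⟨ linear-+ u (ι k * u) ⟩
        linear u * linear (ι k * u)       ≡⟨ cong (linear u *_) (linear-ι* k) ⟩
        linear u * linear u ^ k           ∎
        where open ≡-Reasoning
      linear[u]ᵖ≡1 : linear u ^ p ≡ 1#
      linear[u]ᵖ≡1 = trans (sym (linear-ι* p)) (trans (cong (λ v → linear (v * u)) ι[p]≡0) (linear-ι* 0))
      linear[u]¹≡1 : linear u ^ 1 ≡ 1#
      linear[u]¹≡1 = ^-gcd≡1 (linear u) (coprime-Bézout p⊥n) linear[u]ᵖ≡1 (S-^n≡1 (f-G (translation u) (translation-G u)))

    α-homo-+ : ∀ a b → α (a + b) ≡ α a + α b
    α-homo-+ a b = begin
      α (a + b)                                        ≡⟨ cong (proj₂ ∘ f) (sym (translation-∘ b a)) ⟩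
      proj₂ (f (translation b ∘ᵃ translation a))       ≡⟨ cong proj₂ (f-homo _ _ (translation-G b) (translation-G a)) ⟩
      proj₂ (f (translation b) ∘ᵃ f (translation a))   ≡⟨ cong₂ (λ g h → proj₂ (g ∘ᵃ h)) (f-translation b) (f-translation a) ⟩
      1# * α a + α b                                   ≡⟨ cong (_+ α b) (*-identityˡ (α a)) ⟩
      α a + α b                                        ∎
      where open ≡-Reasoning

    α-x : ∀ a → α (x₁ * a) ≡ x₂ * α a
    α-x a = begin
      α (x₁ * a)                                          ≡⟨ sym (trans (cong (_+ α (x₁ * a)) (zeroʳ 1#)) (+-identityˡ _)) ⟩
      proj₂ (translation (α (x₁ * a)) ∘ᵃ mult x₂)         ≡⟨ cong proj₂ (sym (trans (f-homo _ _ (translation-G (x₁ * a)) mult-x₁-G)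
                                                             (cong₂ _∘ᵃ_ (f-translation (x₁ * a)) f-x))) ⟩
      proj₂ (f (translation (x₁ * a) ∘ᵃ mult x₁))         ≡⟨ cong (proj₂ ∘ f) (trans commute₁ (sym commute₂)) ⟩
      proj₂ (f (mult x₁ ∘ᵃ translation a))                ≡⟨ cong proj₂ (trans (f-homo _ _ mult-x₁-G (translation-G a))
                                                             (cong₂ _∘ᵃ_ f-x (f-translation a))) ⟩
      proj₂ (mult x₂ ∘ᵃ translation (α a))                ≡⟨ +-identityʳ _ ⟩
      x₂ * α a                                            ∎
      where
      open ≡-Reasoning
      commute₁ : translation (x₁ * a) ∘ᵃ mult x₁ ≡ (x₁ , x₁ * a)
      commute₁ = cong₂ _,_ (*-identityˡ x₁) (trans (cong (_+ x₁ * a) (zeroʳ 1#)) (+-identityˡ _))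
      commute₂ : mult x₁ ∘ᵃ translation a ≡ (x₁ , x₁ * a)
      commute₂ = cong₂ _,_ (*-identityʳ x₁) (+-identityʳ _)

    f-normal : ∀ c → f (x₁ ^ c , 1#) ≡ (1# * x₂ ^ c , 1# * 0# + α 1#)
    f-normal c = begin
      f (x₁ ^ c , 1#)                           ≡⟨ cong f (cong₂ _,_ (sym (*-identityˡ _)) (sym (trans (cong (_+ 1#) (zeroʳ 1#)) (+-identityˡ 1#)))) ⟩
      f (translation 1# ∘ᵃ mult (x₁ ^ c))       ≡⟨ f-homo _ _ (translation-G 1#) (c , refl) ⟩
      f (translation 1#) ∘ᵃ f (mult (x₁ ^ c))   ≡⟨ cong₂ _∘ᵃ_ (f-translation 1#) (f-mult-^ c) ⟩
      translation (α 1#) ∘ᵃ mult (x₂ ^ c)       ∎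
      where open ≡-Reasoning

module Classification (F : Field) {n p d : ℕ} .{{_ : ℕ.NonZero n}} (p-prime : Prime p) (p⊥n : Coprime p n)
                      (d-order : IsMultOrder n p d) (size : HasSize F (p ℕ.^ d)) where
  open FieldProperties F
  open Frobenius F {d = d} p-prime size
  open FrobeniusOrbits F p-prime p⊥n d-order size public
  open Order F
  open Paley F

  -- f (u , v) = (σ u , σ v / σ b) with σ = frob e, whose inverse is frob (d ∸ e).
  frob-iso : ∀ {D D′ : GPData n} e → e ℕ.≤ d → frob e (GPData.x D) ≡ GPData.x D′ →
             frob e (proj₁ (GPData.y D)) ≡ proj₁ (GPData.y D′) → proj₂ (GPData.y D′) ≡ 1# → Iso D D′
  frob-iso {gp x (a , b) _ y∈G y∉S} {gp x′ (a′ , b′) _ _ _} e e≤d σx≡x′ σa≡a′ b′≡1 =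
    f , f-G , f-homo , f-injective , f-surjective , cong₂ _,_ σx≡x′ (trans (cong (_* μ) (frob-0# e)) (zeroˡ μ)) , f-y
    where
    σ⁻¹ = frob (d ∸ e)
    σb≢0 : frob e b ≢ 0#
    σb≢0 = ^≢0 (p ℕ.^ e) (λ b≡0 → y∉S (y∈G , b≡0))
    μ = proj₁ (inverse (frob e b) σb≢0)
    σb*μ≡1 : frob e b * μ ≡ 1#
    σb*μ≡1 = proj₂ (inverse (frob e b) σb≢0)
    f : Aff → Aff
    f (u , v) = frob e u , frob e v * μ
    σ-injective : ∀ {u v} → frob e u ≡ frob e v → u ≡ v
    σ-injective {u} {v} σu≡σv = trans (sym (frob-inverseʳ e≤d u)) (trans (cong σ⁻¹ σu≡σv) (frob-inverseʳ e≤d v))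
    σ-S : ∀ k → frob e (x ^ k) ≡ x′ ^ k
    σ-S k = trans (frob-homo-^ e x k) (cong (_^ k) σx≡x′)
    f-G : ∀ g → InG x g → InG x′ (f g)
    f-G (u , v) (k , u≡xᵏ) = k , trans (cong (frob e) u≡xᵏ) (σ-S k)
    f-homo : ∀ g h → InG x g → InG x h → f (g ∘ᵃ h) ≡ f g ∘ᵃ f h
    f-homo (u₁ , v₁) (u₂ , v₂) _ _ = cong₂ _,_ (frob-homo-* e u₁ u₂) (begin
      frob e (u₁ * v₂ + v₁) * μ                    ≡⟨ cong (_* μ) (trans (frob-homo-+ e _ v₁) (cong (_+ frob e v₁) (frob-homo-* e u₁ v₂))) ⟩
      (frob e u₁ * frob e v₂ + frob e v₁) * μ      ≡⟨ distribʳ μ _ _ ⟩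
      frob e u₁ * frob e v₂ * μ + frob e v₁ * μ    ≡⟨ cong (_+ frob e v₁ * μ) (*-assoc _ _ μ) ⟩
      frob e u₁ * (frob e v₂ * μ) + frob e v₁ * μ  ∎)
      where open ≡-Reasoning
    f-injective : ∀ g h → InG x g → InG x h → f g ≡ f h → g ≡ h
    f-injective (u₁ , v₁) (u₂ , v₂) _ _ fg≡fh =
      cong₂ _,_ (σ-injective (cong proj₁ fg≡fh)) (σ-injective (*-cancelʳ (inverse≢0 σb≢0) (cong proj₂ fg≡fh)))
    f-surjective : ∀ g′ → InG x′ g′ → ∃[ g ] (InG x g × f g ≡ g′)
    f-surjective (u′ , v′) (k , u′≡x′ᵏ) = (x ^ k , σ⁻¹ (v′ * frob e b)) , (k , refl) , cong₂ _,_ (trans (σ-S k) (sym u′≡x′ᵏ)) (begin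
      frob e (σ⁻¹ (v′ * frob e b)) * μ   ≡⟨ cong (_* μ) (frob-inverseˡ e≤d _) ⟩
      v′ * frob e b * μ                  ≡⟨ *-assoc v′ _ μ ⟩
      v′ * (frob e b * μ)                ≡⟨ cong (v′ *_) σb*μ≡1 ⟩
      v′ * 1#                            ≡⟨ *-identityʳ v′ ⟩
      v′                                 ∎)
      where open ≡-Reasoning
    f-y : f (a , b) ≡ (a′ , b′)
    f-y = cong₂ _,_ σa≡a′ (trans σb*μ≡1 (sym b′≡1))

  canonicals : Fin #orbits ↔ (Σ[ c ∈ Carrier ] T (isCanonical c))
  canonicals = enumerate-Carrier isCanonical

  representative : Fin #orbits → Carrier
  representative o = proj₁ (Inverse.to canonicals o)

  representative-canonical : ∀ o → IsCanonical (representative o)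
  representative-canonical o = canonical⁻¹ (proj₂ (Inverse.to canonicals o))

  representative-injective : ∀ {o₁ o₂} → representative o₁ ≡ representative o₂ → o₁ ≡ o₂
  representative-injective {o₁} {o₂} rep₁≡rep₂ =
    trans (sym (Inverse.strictlyInverseʳ canonicals o₁))
          (trans (cong (Inverse.from canonicals) (Σ-T-≡ rep₁≡rep₂)) (Inverse.strictlyInverseʳ canonicals o₂))

  normal : Fin n → Fin #orbits → GPData n
  normal c o = gp (representative o) (representative o ^ Fin.toℕ c , 1#) (proj₁ (representative-canonical o))
                  (Fin.toℕ c , refl) (1≢0 ∘ proj₂)

  normal-injective : ∀ c₁ o₁ c₂ o₂ → Iso (normal c₁ o₁) (normal c₂ o₂) → c₁ ≡ c₂ × o₁ ≡ o₂
  normal-injective c₁ o₁ c₂ o₂ (f , f-G , f-homo , _ , _ , f-x , f-y) =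
    Fin.toℕ-injective (^-injective x₂-generator (Fin.toℕ<n c₁) (Fin.toℕ<n c₂) same-colour) ,
    representative-injective (canonical-unique (representative-canonical o₁) (representative-canonical o₂)
      (proj₁ (proj₂ conjugate)) (proj₂ (proj₂ conjugate)))
    where
    x₂-generator = proj₁ (representative-canonical o₂)
    open IsomorphismInvariants F x₂-generator f f-G f-homo f-x
    image = trans (sym (f-normal ι[p]≡0 p⊥n (Fin.toℕ c₁))) f-y
    same-colour : representative o₂ ^ Fin.toℕ c₁ ≡ representative o₂ ^ Fin.toℕ c₂
    same-colour = trans (sym (*-identityˡ _)) (cong proj₁ image)
    α-isUnitalAdditive : IsUnitalAdditive (α ι[p]≡0 p⊥n)
    α-isUnitalAdditive = record
      { +-homo  = α-homo-+ ι[p]≡0 p⊥n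
      ; 1#-homo = trans (sym (trans (cong (_+ α ι[p]≡0 p⊥n 1#) (zeroʳ 1#)) (+-identityˡ _))) (cong proj₂ image)
      }
    conjugate = intertwiner⇒conjugate (proj₁ (representative-canonical o₁)) α-isUnitalAdditive (α-x ι[p]≡0 p⊥n)

  normal-covers : ∀ (D : GPData n) c → HasColour D c → ∃[ o ] Iso D (normal c o)
  normal-covers D c a≡xᶜ = o , frob-iso {D} {normal c o} e (ℕ.m∸n≤m d (Fin.toℕ j)) σx≡rep σa≡repᶜ refl
    where
    decomposition = canonical-exists (GPData.ordx D)
    c₀ = proj₁ decomposition
    j = proj₁ (proj₂ decomposition)
    c₀-canonical = proj₁ (proj₂ (proj₂ decomposition))
    e = d ∸ Fin.toℕ j
    o = Inverse.from canonicals (c₀ , canonical c₀-canonical)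
    σx≡rep : frob e (GPData.x D) ≡ representative o
    σx≡rep = trans (cong (frob e) (sym (proj₂ (proj₂ (proj₂ decomposition)))))
      (trans (frob-inverseʳ (ℕ.<⇒≤ (Fin.toℕ<n j)) c₀)
             (sym (cong proj₁ (Inverse.strictlyInverseˡ canonicals (c₀ , canonical c₀-canonical)))))
    σa≡repᶜ : frob e (proj₁ (GPData.y D)) ≡ representative o ^ Fin.toℕ c
    σa≡repᶜ = trans (cong (frob e) a≡xᶜ) (trans (frob-homo-^ e (GPData.x D) (Fin.toℕ c)) (cong (_^ Fin.toℕ c) σx≡rep))

  colour-exists : ∀ (D : GPData n) → ∃[ c ] HasColour D c
  colour-exists (gp x (a , b) x-generator (k , a≡xᵏ) _) =
    Fin.fromℕ< (m%n<n k n) ,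
    trans a≡xᵏ (trans (^≡^[mod] (proj₁ x-generator) k) (cong (x ^_) (sym (Fin.toℕ-fromℕ< (m%n<n k n)))))

  classes-of-colour : ∀ c → ClassCount (λ D → HasColour D c) Iso #orbits
  classes-of-colour c = normal c , (λ _ → refl) , (λ o₁ o₂ → proj₂ ∘ normal-injective c o₁ c o₂) , λ D → normal-covers D c

  classes : ClassCount (λ _ → ⊤) Iso (n ℕ.* #orbits)
  classes = normal′ , (λ _ → _) , normal′-injective , covers
    where
    split : Fin (n ℕ.* #orbits) ↔ (Fin n × Fin #orbits)
    split = *↔×
    normal′ : Fin (n ℕ.* #orbits) → GPData n
    normal′ = uncurry normal ∘ Inverse.to split
    normal′-injective : ∀ i j → Iso (normal′ i) (normal′ j) → i ≡ j
    normal′-injective i j iso = trans (sym (Inverse.strictlyInverseʳ split i))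
      (trans (cong (Inverse.from split) (uncurry (cong₂ _,_) (normal-injective _ _ _ _ iso))) (Inverse.strictlyInverseʳ split j))
    covers : ∀ D → ⊤ → ∃[ i ] Iso D (normal′ i)
    covers D _ = Inverse.from split (c , o) , subst (Iso D ∘ uncurry normal) (sym (Inverse.strictlyInverseˡ split (c , o))) iso
      where
      c = proj₁ (colour-exists D)
      o = proj₁ (normal-covers D c (proj₂ (colour-exists D)))
      iso = proj₂ (normal-covers D c (proj₂ (colour-exists D)))

open import Data.Nat using (_≤_; _*_; _^_; NonZero)

proposition4p2 : (n p d : ℕ) → 1 ≤ n → Prime p → Coprime p n →
    IsMultOrder n p d → .{{_ : NonZero d}} →
    (F : Field) → HasSize F (p ^ d) →
    ClassCount {Paley.GPData F n} (λ _ → ⊤) (Paley.Iso F) ((n * φ n) / d)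
    × ((c : Fin n) →
       ClassCount {Paley.GPData F n} (λ D → Paley.HasColour F D c) (Paley.Iso F) (φ n / d))
proposition4p2 n p d 1≤n p-prime p⊥n d-order F size =
  subst (ClassCount _ (Paley.Iso F)) (sym n*φ/d≡n*#orbits) classes ,
  λ c → subst (ClassCount _ (Paley.Iso F)) (sym φ/d≡#orbits) (classes-of-colour c)
  where
  instance _ = ℕ.>-nonZero 1≤n
  open Classification F p-prime p⊥n d-order size
  φ/d≡#orbits : φ n / d ≡ #orbits
  φ/d≡#orbits = trans (cong (_/ d) φ≡#orbits*d) (m*n/n≡m #orbits d)
  n*φ/d≡n*#orbits : (n * φ n) / d ≡ n * #orbits
  n*φ/d≡n*#orbits = trans (cong (λ m → (n * m) / d) φ≡#orbits*d)
                          (trans (cong (_/ d) (sym (ℕ.*-assoc n #orbits d))) (m*n/n≡m (n * #orbits) d))
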